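{- Let $m\in\mathbb Z$ and $i\geq 2$. (i) If $m=N_i(1+(x-1)^5h(x))$ for some $h\in\mathbb Z[x]$, then for every $j$ with $2\le j\le i$ there is $h_j\in\mathbb Z[x]$ with $m=N_j(1+(x-1)^5h_j(x))$ and $3\mid h_j(1)$ if and only if $3\mid h(1)$; and moreover $3m=N_1\big(1-x+9(A+B(1-x))\big)$ for some $A,B\in\mathbb Z$ with $3\nmid A$ if $3\nmid h(1)$ and $3\mid A$ if $3\mid h(1)$. (ii) If $m=N_i(1+(x-1)^7t(x))$ for some $t\in\mathbb Z[x]$, then for every $j$ with $2\le j\le i$ there is $t_j\in\mathbb Z[x]$ with $m=N_j(1+(x-1)^7t_j(x))$ and $3\mid t_j(1)$ if and only if $3\mid t(1)$.
   Context: For $k\geq1$, $\omega_k=e^{2\pi i/3^k}$ and for $G\in\mathbb Z[x]$, $N_k(G)=\prod_{1\le \ell\le 3^k,\ 3\nmid \ell}G(\omega_k^\ell)$. -}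

module Defs where

open import Data.Nat as ℕ using (ℕ; zero; suc; _^_; _%_; _≡ᵇ_)
open import Data.Integer as ℤ using (ℤ; +_; -_)
open import Data.List using (List; []; _∷_; map; upTo; filterᵇ; foldr)
open import Data.Bool using (not)
open import Data.Product using (∃)
open import Relation.Binary.PropositionalEquality using (_≡_)

-- Integer polynomials Z[x], as coefficient lists (constant term first).
-- Trailing zeros are allowed; equality is taken coefficientwise.
Poly : Set
Poly = List ℤ

coeff : Poly → ℕ → ℤ
coeff []      _       = + 0
coeff (a ∷ p) zero    = a
coeff (a ∷ p) (suc n) = coeff p n

infixl 6 _⊕_ _⊟_
infixl 7 _⊛_ _·_

_⊕_ : Poly → Poly → Poly
[]      ⊕ q       = q
(a ∷ p) ⊕ []      = a ∷ p
(a ∷ p) ⊕ (b ∷ q) = (a ℤ.+ b) ∷ (p ⊕ q)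

_·_ : ℤ → Poly → Poly
c · p = map (c ℤ.*_) p

_⊟_ : Poly → Poly → Poly
p ⊟ q = p ⊕ ((- + 1) · q)

_⊛_ : Poly → Poly → Poly
[]      ⊛ q = []
(a ∷ p) ⊛ q = (a · q) ⊕ (+ 0 ∷ (p ⊛ q))

const : ℤ → Poly
const c = c ∷ []

X : Poly
X = + 0 ∷ + 1 ∷ []

_^ₚ_ : Poly → ℕ → Poly
p ^ₚ zero  = const (+ 1)
p ^ₚ suc n = p ⊛ (p ^ₚ n)

_∘ₚ_ : Poly → Poly → Poly
[]      ∘ₚ q = []
(a ∷ p) ∘ₚ q = const a ⊕ (q ⊛ (p ∘ₚ q))

at1 : Poly → ℤ
at1 = foldr ℤ._+_ (+ 0)

prodP : List Poly → Poly
prodP = foldr _⊛_ (const (+ 1))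

-- Cyclotomic polynomial Φ_{3^k}(x) = 1 + x^{3^(k-1)} + x^{2·3^(k-1)}  (k ≥ 1),
-- the minimal polynomial of ω_k = e^{2πi/3^k}.
Φ3 : ℕ → Poly
Φ3 k = const (+ 1) ⊕ (X ^ₚ (3 ^ (k ℕ.∸ 1))) ⊕ (X ^ₚ (2 ℕ.* 3 ^ (k ℕ.∸ 1)))

units : ℕ → List ℕ
units k = filterᵇ (λ ℓ → not (ℓ % 3 ≡ᵇ 0)) (map suc (upTo (3 ^ k)))

-- ∏_{ℓ} G(x^ℓ) as an element of Z[x]; substituting x = ω_k gives N_k(G).
normPoly : ℕ → Poly → Poly
normPoly k G = prodP (map (λ ℓ → G ∘ₚ (X ^ₚ ℓ)) (units k))

-- "m = N_k(G)": computed in Z[ω_k] ≅ Z[x]/(Φ_{3^k}), i.e.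
-- ∏_ℓ G(x^ℓ) ≡ m  (mod Φ_{3^k}) in Z[x].
NormEq : ℕ → Poly → ℤ → Set
NormEq k G m = ∃ λ (Q : Poly) → ∀ n → coeff (normPoly k G) n ≡ coeff (const m ⊕ (Φ3 k ⊛ Q)) n

{-# OPTIONS --safe #-}
-- Write ρ = X − 1 and G = 1 + ρ^e h. The units ℓ modulo 3^(k+2) come in triples ℓ, ℓ + N, ℓ + 2N
-- with ℓ a unit modulo N = 3^(k+1), and X^N is a primitive cube root of unity modulo Φ_{3^(k+2)};
-- so N_{k+2}(G) = N_{k+1}(G′), where G′ is the norm of G from ℤ[X] down to ℤ[X³] (rewritten in
-- the variable X³ ↦ X), a cubic form in the three components of G. Expanding the norm,
-- G′ = 1 + 3E + ρ^e N(h). At every level ≥ 2, 3 is ρ⁶ times a unit; for e = 7 moreover E lies in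
-- the ideal (3, ρ²). Either way 3E is a multiple of ρ^(e+1), so G′ ≡ 1 + ρ^e h′ with h′ ≡ N(h)
-- modulo ρ, and N(h)(1) ≡ h(1)³ (mod 3). Iterating lowers the level from i to any j ≥ 2.
-- At level 1 (ℤ[ω] with ω² + ω + 1 = 0) one has ρ² = −3ω, which turns (1 − X)G′ into
-- (1 − X) + 9(A + B(1 − X)) with A ≡ h(1) (mod 3), while N₁(1 − X) = 3.

module Submission where

open import Defs
open import Data.Nat using (ℕ; _≤_)
open import Data.Integer using (ℤ; +_; -_; _*_)
open import Data.Integer.Divisibility using (_∣_)
open import Data.Product using (_×_; ∃; ∃₂)
open import Function.Bundles using (_⇔_)
open import Relation.Nullary using (¬_)

open import Level using (0ℓ)
open import Algebra.Bundles using (CommutativeRing)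
open import Algebra.Structures using (IsCommutativeRing)
import Algebra.Solver.Ring
open import Algebra.Solver.Ring.AlmostCommutativeRing using (_-Raw-AlmostCommutative⟶_; fromCommutativeRing)
open import Data.Bool using (Bool; true; false; not)
open import Data.Empty using (⊥-elim)
open import Data.Integer as ℤ using (_+_; _-_; _^_; ∣_∣)
import Data.Integer.Properties as ℤₚ
import Data.Integer.Divisibility.Signed as Signed
open import Data.Integer.Tactic.RingSolver using (solve-∀)
open import Data.List using (List; []; _∷_; _++_; map; upTo; applyUpTo; filterᵇ)
open import Data.List.Properties using (map-++; map-∘; map-cong; map-upTo; filter-++)
open import Data.List.Relation.Unary.All as All using (All; []; _∷_)
open import Data.List.Relation.Unary.All.Properties using (all-filter)
open import Data.Maybe using (Maybe; just; nothing)
open import Data.Nat as ℕ using (zero; suc; s≤s; z≤n; _%_; _/_; _≡ᵇ_)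
import Data.Nat.Divisibility as ℕᵈ
import Data.Nat.Properties as ℕₚ
open import Data.Nat.DivMod using (m≡m%n+[m/n]*n; m%n<n; [m+kn]%n≡m%n)
open import Data.Nat.Primality using (Prime; prime?; euclidsLemma)
open import Data.Product using (_,_; proj₁; proj₂)
open import Data.Sum using (inj₁; inj₂)
open import Function using (_∘_; id)
open import Function.Bundles using (Equivalence; mk⇔)
open import Function.Properties.Equivalence using (⇔-isEquivalence)
open import Relation.Binary.Structures using (IsEquivalence)
open import Relation.Binary.PropositionalEquality
  using (_≡_; _≢_; refl; sym; trans; cong; cong₂; subst; module ≡-Reasoning)
open import Relation.Nullary using (Dec; yes; no)
open import Relation.Nullary.Decidable using (T?; map′; _×-dec_; from-yes; toWitness)

infix 4 _≈_
record _≈_ (p q : Poly) : Set where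
  constructor coeffwise
  field coeff-≡ : ∀ n → coeff p n ≡ coeff q n
open _≈_ public

≈-refl : ∀ {p} → p ≈ p
≈-refl = coeffwise λ _ → refl

≈-reflexive : ∀ {p q} → p ≡ q → p ≈ q
≈-reflexive refl = ≈-refl

≈-sym : ∀ {p q} → p ≈ q → q ≈ p
≈-sym p≈q = coeffwise λ n → sym (coeff-≡ p≈q n)

≈-trans : ∀ {p q r} → p ≈ q → q ≈ r → p ≈ r
≈-trans p≈q q≈r = coeffwise λ n → trans (coeff-≡ p≈q n) (coeff-≡ q≈r n)

infixr 2 _⟨≈⟩_
_⟨≈⟩_ : ∀ {p q r} → p ≈ q → q ≈ r → p ≈ r
_⟨≈⟩_ = ≈-trans

≈-isEquivalence : IsEquivalence _≈_
≈-isEquivalence = record { refl = ≈-refl ; sym = ≈-sym ; trans = ≈-trans }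

∷-cong : ∀ {a b p q} → a ≡ b → p ≈ q → a ∷ p ≈ b ∷ q
∷-cong {a} {b} {p} {q} a≡b p≈q = coeffwise λ where
  zero    → a≡b
  (suc n) → coeff-≡ p≈q n

∷-injectiveˡ : ∀ {a b p q} → a ∷ p ≈ b ∷ q → a ≡ b
∷-injectiveˡ e = coeff-≡ e zero

∷-injectiveʳ : ∀ {a b p q} → a ∷ p ≈ b ∷ q → p ≈ q
∷-injectiveʳ e = coeffwise λ n → coeff-≡ e (suc n)

[]≈0∷[] : [] ≈ + 0 ∷ []
[]≈0∷[] = coeffwise λ where
  zero    → refl
  (suc n) → refl

0∷-zero : ∀ {p} → p ≈ [] → + 0 ∷ p ≈ []
0∷-zero p≈0 = ∷-cong refl p≈0 ⟨≈⟩ ≈-sym []≈0∷[]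

neg : Poly → Poly
neg p = (- + 1) · p

coeff-⊕ : ∀ p q n → coeff (p ⊕ q) n ≡ coeff p n + coeff q n
coeff-⊕ []      q       n       = sym (ℤₚ.+-identityˡ (coeff q n))
coeff-⊕ (a ∷ p) []      n       = sym (ℤₚ.+-identityʳ (coeff (a ∷ p) n))
coeff-⊕ (a ∷ p) (b ∷ q) zero    = refl
coeff-⊕ (a ∷ p) (b ∷ q) (suc n) = coeff-⊕ p q n

coeff-· : ∀ c p n → coeff (c · p) n ≡ c * coeff p n
coeff-· c []      n       = sym (ℤₚ.*-zeroʳ c)
coeff-· c (a ∷ p) zero    = refl
coeff-· c (a ∷ p) (suc n) = coeff-· c p n

⊕-cong : ∀ {p p′ q q′} → p ≈ p′ → q ≈ q′ → p ⊕ q ≈ p′ ⊕ q′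
⊕-cong {p} {p′} {q} {q′} p≈p′ q≈q′ = coeffwise λ n → begin
  coeff (p ⊕ q) n          ≡⟨ coeff-⊕ p q n ⟩
  coeff p n + coeff q n    ≡⟨ cong₂ _+_ (coeff-≡ p≈p′ n) (coeff-≡ q≈q′ n) ⟩
  coeff p′ n + coeff q′ n  ≡⟨ coeff-⊕ p′ q′ n ⟨
  coeff (p′ ⊕ q′) n        ∎
  where open ≡-Reasoning

⊕-congˡ : ∀ p {q q′} → q ≈ q′ → p ⊕ q ≈ p ⊕ q′
⊕-congˡ p = ⊕-cong (≈-refl {p})

⊕-congʳ : ∀ {p p′} q → p ≈ p′ → p ⊕ q ≈ p′ ⊕ q
⊕-congʳ q p≈p′ = ⊕-cong p≈p′ (≈-refl {q})

·-congˡ : ∀ c {p q} → p ≈ q → c · p ≈ c · q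
·-congˡ c {p} {q} p≈q = coeffwise λ n → begin
  coeff (c · p) n  ≡⟨ coeff-· c p n ⟩
  c * coeff p n    ≡⟨ cong (c *_) (coeff-≡ p≈q n) ⟩
  c * coeff q n    ≡⟨ coeff-· c q n ⟨
  coeff (c · q) n  ∎
  where open ≡-Reasoning

⊕-comm : ∀ p q → p ⊕ q ≈ q ⊕ p
⊕-comm p q = coeffwise λ n → begin
  coeff (p ⊕ q) n        ≡⟨ coeff-⊕ p q n ⟩
  coeff p n + coeff q n  ≡⟨ ℤₚ.+-comm (coeff p n) (coeff q n) ⟩
  coeff q n + coeff p n  ≡⟨ coeff-⊕ q p n ⟨
  coeff (q ⊕ p) n        ∎
  where open ≡-Reasoning

⊕-assoc : ∀ p q r → (p ⊕ q) ⊕ r ≈ p ⊕ (q ⊕ r)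
⊕-assoc p q r = coeffwise λ n → begin
  coeff ((p ⊕ q) ⊕ r) n                ≡⟨ coeff-⊕ (p ⊕ q) r n ⟩
  coeff (p ⊕ q) n + coeff r n          ≡⟨ cong (_+ coeff r n) (coeff-⊕ p q n) ⟩
  (coeff p n + coeff q n) + coeff r n  ≡⟨ ℤₚ.+-assoc (coeff p n) (coeff q n) (coeff r n) ⟩
  coeff p n + (coeff q n + coeff r n)  ≡⟨ cong (λ z → coeff p n + z) (coeff-⊕ q r n) ⟨
  coeff p n + coeff (q ⊕ r) n          ≡⟨ coeff-⊕ p (q ⊕ r) n ⟨
  coeff (p ⊕ (q ⊕ r)) n                ∎
  where open ≡-Reasoning

⊕-identityʳ : ∀ p → p ⊕ [] ≈ p
⊕-identityʳ p = coeffwise λ n → trans (coeff-⊕ p [] n) (ℤₚ.+-identityʳ (coeff p n))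

⊕-inverseʳ : ∀ p → p ⊕ neg p ≈ []
⊕-inverseʳ p = coeffwise λ n → begin
  coeff (p ⊕ neg p) n                ≡⟨ coeff-⊕ p (neg p) n ⟩
  coeff p n + coeff ((- + 1) · p) n  ≡⟨ cong (λ z → coeff p n + z) (coeff-· (- + 1) p n) ⟩
  coeff p n + (- + 1) * coeff p n    ≡⟨ x-x≡0 (coeff p n) ⟩
  + 0                                ∎
  where
  open ≡-Reasoning
  x-x≡0 : ∀ x → x + (- + 1) * x ≡ + 0
  x-x≡0 = solve-∀

·-distribˡ-⊕ : ∀ c p q → c · (p ⊕ q) ≈ c · p ⊕ c · q
·-distribˡ-⊕ c p q = coeffwise λ n → begin
  coeff (c · (p ⊕ q)) n              ≡⟨ coeff-· c (p ⊕ q) n ⟩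
  c * coeff (p ⊕ q) n                ≡⟨ cong (c *_) (coeff-⊕ p q n) ⟩
  c * (coeff p n + coeff q n)        ≡⟨ ℤₚ.*-distribˡ-+ c (coeff p n) (coeff q n) ⟩
  c * coeff p n + c * coeff q n      ≡⟨ cong₂ _+_ (coeff-· c p n) (coeff-· c q n) ⟨
  coeff (c · p) n + coeff (c · q) n  ≡⟨ coeff-⊕ (c · p) (c · q) n ⟨
  coeff (c · p ⊕ c · q) n            ∎
  where open ≡-Reasoning

·-assoc : ∀ c d p → c · (d · p) ≈ (c * d) · p
·-assoc c d p = coeffwise λ n → begin
  coeff (c · (d · p)) n  ≡⟨ coeff-· c (d · p) n ⟩
  c * coeff (d · p) n    ≡⟨ cong (c *_) (coeff-· d p n) ⟩
  c * (d * coeff p n)    ≡⟨ ℤₚ.*-assoc c d (coeff p n) ⟨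
  (c * d) * coeff p n    ≡⟨ coeff-· (c * d) p n ⟨
  coeff ((c * d) · p) n  ∎
  where open ≡-Reasoning

0·-zero : ∀ p → + 0 · p ≈ []
0·-zero p = coeffwise λ n → trans (coeff-· (+ 0) p n) (ℤₚ.*-zeroˡ (coeff p n))

1·-identity : ∀ p → + 1 · p ≈ p
1·-identity p = coeffwise λ n → trans (coeff-· (+ 1) p n) (ℤₚ.*-identityˡ (coeff p n))

⊕-interchange : ∀ p q r s → (p ⊕ q) ⊕ (r ⊕ s) ≈ (p ⊕ r) ⊕ (q ⊕ s)
⊕-interchange p q r s =
  ⊕-assoc p q (r ⊕ s) ⟨≈⟩ ⊕-congˡ p (≈-sym (⊕-assoc q r s) ⟨≈⟩ ⊕-congʳ s (⊕-comm q r) ⟨≈⟩ ⊕-assoc r q s)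
  ⟨≈⟩ ≈-sym (⊕-assoc p r (q ⊕ s))

⊛-zeroˡ : ∀ {p} q → p ≈ [] → p ⊛ q ≈ []
⊛-zeroˡ {[]}    q p≈0 = ≈-refl
⊛-zeroˡ {a ∷ p} q p≈0 rewrite coeff-≡ p≈0 zero =
  ⊕-cong (0·-zero q) (0∷-zero (⊛-zeroˡ {p} q (coeffwise λ n → coeff-≡ p≈0 (suc n))))

⊛-zeroʳ : ∀ p → p ⊛ [] ≈ []
⊛-zeroʳ []      = ≈-refl
⊛-zeroʳ (a ∷ p) = 0∷-zero (⊛-zeroʳ p)

⊛-congʳ : ∀ {p p′} q → p ≈ p′ → p ⊛ q ≈ p′ ⊛ q
⊛-congʳ {[]}    {[]}     q e = ≈-refl
⊛-congʳ {[]}    {b ∷ p′} q e = ≈-sym (⊛-zeroˡ q (≈-sym e))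
⊛-congʳ {a ∷ p} {[]}     q e = ⊛-zeroˡ q e
⊛-congʳ {a ∷ p} {b ∷ p′} q e rewrite ∷-injectiveˡ e =
  ⊕-cong ≈-refl (∷-cong refl (⊛-congʳ q (∷-injectiveʳ e)))

⊛-congˡ : ∀ p {q q′} → q ≈ q′ → p ⊛ q ≈ p ⊛ q′
⊛-congˡ []      e = ≈-refl
⊛-congˡ (a ∷ p) e = ⊕-cong (·-congˡ a e) (∷-cong refl (⊛-congˡ p e))

⊛-cong : ∀ {p p′ q q′} → p ≈ p′ → q ≈ q′ → p ⊛ q ≈ p′ ⊛ q′
⊛-cong {p′ = p′} {q = q} p≈p′ q≈q′ = ⊛-congʳ q p≈p′ ⟨≈⟩ ⊛-congˡ p′ q≈q′

⊛-0∷ : ∀ p q → p ⊛ (+ 0 ∷ q) ≈ + 0 ∷ (p ⊛ q)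
⊛-0∷ []      q = ≈-sym (0∷-zero ≈-refl)
⊛-0∷ (a ∷ p) q =
  ∷-cong (trans (ℤₚ.+-identityʳ (a * + 0)) (ℤₚ.*-zeroʳ a)) (⊕-cong (≈-refl {a · q}) (⊛-0∷ p q))

⊛-const : ∀ p b → p ⊛ const b ≈ b · p
⊛-const []      b = ≈-refl
⊛-const (a ∷ p) b = ∷-cong (trans (ℤₚ.+-identityʳ (a * b)) (ℤₚ.*-comm a b)) (⊛-const p b)

∷-split : ∀ a p → a ∷ p ≈ const a ⊕ (+ 0 ∷ p)
∷-split a p = ∷-cong (sym (ℤₚ.+-identityʳ a)) ≈-refl

⊛-distribˡ : ∀ p q r → p ⊛ (q ⊕ r) ≈ p ⊛ q ⊕ p ⊛ r
⊛-distribˡ []      q r = ≈-refl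
⊛-distribˡ (a ∷ p) q r =
  ⊕-cong (·-distribˡ-⊕ a q r) (∷-cong (sym (ℤₚ.+-identityʳ (+ 0))) (⊛-distribˡ p q r))
  ⟨≈⟩ ⊕-interchange (a · q) (a · r) (+ 0 ∷ (p ⊛ q)) (+ 0 ∷ (p ⊛ r))

⊛-comm : ∀ p q → p ⊛ q ≈ q ⊛ p
⊛-comm []      q = ≈-sym (⊛-zeroʳ q)
⊛-comm (a ∷ p) q =
  ⊕-cong (≈-sym (⊛-const q a)) (∷-cong refl (⊛-comm p q) ⟨≈⟩ ≈-sym (⊛-0∷ q p))
  ⟨≈⟩ ≈-sym (⊛-distribˡ q (const a) (+ 0 ∷ p)) ⟨≈⟩ ⊛-congˡ q (≈-sym (∷-split a p))

⊛-distribʳ : ∀ p q r → (q ⊕ r) ⊛ p ≈ q ⊛ p ⊕ r ⊛ p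
⊛-distribʳ p q r =
  ⊛-comm (q ⊕ r) p ⟨≈⟩ ⊛-distribˡ p q r ⟨≈⟩ ⊕-cong (⊛-comm p q) (⊛-comm p r)

·-⊛ : ∀ c p q → (c · p) ⊛ q ≈ c · (p ⊛ q)
·-⊛ c []      q = ≈-refl
·-⊛ c (a ∷ p) q =
  ⊕-cong (≈-sym (·-assoc c a q)) (∷-cong (sym (ℤₚ.*-zeroʳ c)) (·-⊛ c p q))
  ⟨≈⟩ ≈-sym (·-distribˡ-⊕ c (a · q) (+ 0 ∷ (p ⊛ q)))

⊛-assoc : ∀ p q r → (p ⊛ q) ⊛ r ≈ p ⊛ (q ⊛ r)
⊛-assoc []      q r = ≈-refl
⊛-assoc (a ∷ p) q r =
  ⊛-distribʳ r (a · q) (+ 0 ∷ (p ⊛ q))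
  ⟨≈⟩ ⊕-cong (·-⊛ a q r) (⊕-cong (0·-zero r) ≈-refl ⟨≈⟩ ∷-cong refl (⊛-assoc p q r))

⊛-identityˡ : ∀ p → const (+ 1) ⊛ p ≈ p
⊛-identityˡ p = ⊕-cong (1·-identity p) (≈-sym []≈0∷[]) ⟨≈⟩ ⊕-identityʳ p

infix 4 _≈?_
_≈?_ : ∀ p q → Dec (p ≈ q)
[]      ≈? []      = yes ≈-refl
[]      ≈? (b ∷ q) = map′ (λ (0≡b , []≈q) → []≈0∷[] ⟨≈⟩ ∷-cong 0≡b []≈q)
                          (λ e → coeff-≡ e zero , coeffwise λ n → coeff-≡ e (suc n))
                          ((+ 0 ℤ.≟ b) ×-dec ([] ≈? q))
(a ∷ p) ≈? []      = map′ (λ (a≡0 , p≈[]) → ∷-cong a≡0 p≈[] ⟨≈⟩ ≈-sym []≈0∷[])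
                          (λ e → coeff-≡ e zero , coeffwise λ n → coeff-≡ e (suc n))
                          ((a ℤ.≟ + 0) ×-dec (p ≈? []))
(a ∷ p) ≈? (b ∷ q) = map′ (λ (a≡b , p≈q) → ∷-cong a≡b p≈q) (λ e → ∷-injectiveˡ e , ∷-injectiveʳ e)
                          ((a ℤ.≟ b) ×-dec (p ≈? q))

·≈const⊛ : ∀ c p → c · p ≈ const c ⊛ p
·≈const⊛ c p = ≈-sym (⊛-comm (const c) p ⟨≈⟩ ⊛-const p c)

-- The ring ℤ[X] and its congruences

ℤ[X]-isCommutativeRing : IsCommutativeRing _≈_ _⊕_ _⊛_ neg [] (const (+ 1))
ℤ[X]-isCommutativeRing = record
  { isRing = record
    { +-isAbelianGroup = record
      { isGroup = record
        { isMonoid = record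
          { isSemigroup = record
            { isMagma = record { isEquivalence = ≈-isEquivalence ; ∙-cong = ⊕-cong }
            ; assoc = ⊕-assoc }
          ; identity = (λ p → ≈-refl) , ⊕-identityʳ }
        ; inverse = (λ p → ⊕-comm (neg p) p ⟨≈⟩ ⊕-inverseʳ p) , ⊕-inverseʳ
        ; ⁻¹-cong = ·-congˡ (- + 1) }
      ; comm = ⊕-comm }
    ; *-cong = ⊛-cong
    ; *-assoc = ⊛-assoc
    ; *-identity = ⊛-identityˡ , (λ p → ⊛-comm p (const (+ 1)) ⟨≈⟩ ⊛-identityˡ p)
    ; distrib = ⊛-distribˡ , ⊛-distribʳ }
  ; *-comm = ⊛-comm }

ℤ[X]-commutativeRing : CommutativeRing 0ℓ 0ℓ
ℤ[X]-commutativeRing = record { isCommutativeRing = ℤ[X]-isCommutativeRing }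

const-morphism : CommutativeRing.rawRing ℤₚ.+-*-commutativeRing
                 -Raw-AlmostCommutative⟶ fromCommutativeRing ℤ[X]-commutativeRing
const-morphism = record
  { ⟦_⟧    = const
  ; +-homo = λ a b → ≈-refl
  ; *-homo = λ a b → ∷-cong (sym (ℤₚ.+-identityʳ (a * b))) ≈-refl
  ; -‿homo = λ a → ∷-cong (sym (ℤₚ.-1*i≡-i a)) ≈-refl
  ; 0-homo = ≈-sym []≈0∷[]
  ; 1-homo = ≈-refl }

const-≟ : ∀ a b → Maybe (const a ≈ const b)
const-≟ a b with a ℤ.≟ b
... | yes refl = just ≈-refl
... | no _     = nothing

module ℤ[X]-Solver = Algebra.Solver.Ring _ _ const-morphism const-≟
open ℤ[X]-Solver using (solve; _:=_; _:+_; _:*_; :-_; _:-_; _:^_; con)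

^-+ : ∀ p m n → p ^ₚ (m ℕ.+ n) ≈ p ^ₚ m ⊛ p ^ₚ n
^-+ p zero    n = ≈-sym (⊛-identityˡ (p ^ₚ n))
^-+ p (suc m) n = ⊛-congˡ p (^-+ p m n) ⟨≈⟩ ≈-sym (⊛-assoc p (p ^ₚ m) (p ^ₚ n))

^-* : ∀ p m n → p ^ₚ (m ℕ.* n) ≈ (p ^ₚ m) ^ₚ n
^-* p m zero    rewrite ℕₚ.*-zeroʳ m = ≈-refl
^-* p m (suc n) rewrite ℕₚ.*-suc m n = ^-+ p m (m ℕ.* n) ⟨≈⟩ ⊛-congˡ (p ^ₚ m) (^-* p m n)

^-distrib-⊛ : ∀ p q n → (p ⊛ q) ^ₚ n ≈ p ^ₚ n ⊛ q ^ₚ n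
^-distrib-⊛ p q zero    = ≈-sym (⊛-identityˡ (const (+ 1)))
^-distrib-⊛ p q (suc n) = ⊛-congˡ (p ⊛ q) (^-distrib-⊛ p q n) ⟨≈⟩
  solve 4 (λ p q a b → (p :* q) :* (a :* b) := (p :* a) :* (q :* b)) ≈-refl p q (p ^ₚ n) (q ^ₚ n)

record PolyCongruence : Set₁ where
  infix 4 _∼_
  field
    _∼_           : Poly → Poly → Set
    isEquivalence : IsEquivalence _∼_
    ≈⇒∼           : ∀ {p q} → p ≈ q → p ∼ q
    +-cong        : ∀ {p p′ q q′} → p ∼ p′ → q ∼ q′ → p ⊕ q ∼ p′ ⊕ q′
    *-cong        : ∀ {p p′ q q′} → p ∼ p′ → q ∼ q′ → p ⊛ q ∼ p′ ⊛ q′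

module Congruence (C : PolyCongruence) where
  open PolyCongruence C public
  open IsEquivalence isEquivalence public renaming (refl to ∼-refl; sym to ∼-sym; trans to ∼-trans)

  +-congˡ : ∀ p {q q′} → q ∼ q′ → p ⊕ q ∼ p ⊕ q′
  +-congˡ p = +-cong (∼-refl {p})

  *-congˡ : ∀ p {q q′} → q ∼ q′ → p ⊛ q ∼ p ⊛ q′
  *-congˡ p = *-cong (∼-refl {p})

  neg-cong : ∀ {p q} → p ∼ q → neg p ∼ neg q
  neg-cong {p} {q} p∼q = ∼-trans (≈⇒∼ (·≈const⊛ (- + 1) p))
    (∼-trans (*-congˡ (const (- + 1)) p∼q) (≈⇒∼ (≈-sym (·≈const⊛ (- + 1) q))))

  ^-cong : ∀ {p q} n → p ∼ q → p ^ₚ n ∼ q ^ₚ n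
  ^-cong zero    p∼q = ∼-refl
  ^-cong (suc n) p∼q = *-cong p∼q (^-cong n p∼q)

  1^n : ∀ n → const (+ 1) ^ₚ n ∼ const (+ 1)
  1^n zero    = ∼-refl
  1^n (suc n) = ∼-trans (*-congˡ (const (+ 1)) (1^n n)) (≈⇒∼ (⊛-identityˡ (const (+ 1))))

  ∘-congˡ : ∀ p {q q′} → q ∼ q′ → p ∘ₚ q ∼ p ∘ₚ q′
  ∘-congˡ []      q∼q′ = ∼-refl
  ∘-congˡ (a ∷ p) q∼q′ = +-congˡ (const a) (*-cong q∼q′ (∘-congˡ p q∼q′))

  prodP-map-cong : ∀ {A : Set} {f g : A → Poly} xs → All (λ x → f x ∼ g x) xs → prodP (map f xs) ∼ prodP (map g xs)
  prodP-map-cong []       []                = ∼-refl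
  prodP-map-cong (x ∷ xs) (fx∼gx ∷ fxs∼gxs) = *-cong fx∼gx (prodP-map-cong xs fxs∼gxs)

coefficientwise : PolyCongruence
coefficientwise = record
  { _∼_ = _≈_ ; isEquivalence = ≈-isEquivalence ; ≈⇒∼ = id ; +-cong = ⊕-cong ; *-cong = ⊛-cong }

module ℤ[X] = Congruence coefficientwise

infix 4 _≈_[mod_]
record _≈_[mod_] (p q M : Poly) : Set where
  constructor congruent
  field
    cofactor   : Poly
    difference : p ≈ q ⊕ M ⊛ cofactor
open _≈_[mod_] public

module _ {M : Poly} where

  ≈⇒≈mod : ∀ {p q} → p ≈ q → p ≈ q [mod M ]
  ≈⇒≈mod {p} {q} p≈q = congruent [] (p≈q ⟨≈⟩ ≈-sym (⊕-congˡ q (⊛-zeroʳ M) ⟨≈⟩ ⊕-identityʳ q))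

  mod-sym : ∀ {p q} → p ≈ q [mod M ] → q ≈ p [mod M ]
  mod-sym {p} {q} (congruent Q e) = congruent (neg Q)
    (solve 3 (λ q M Q → q := (q :+ M :* Q) :+ M :* (:- Q)) ≈-refl q M Q ⟨≈⟩ ⊕-congʳ (M ⊛ neg Q) (≈-sym e))

  mod-trans : ∀ {p q r} → p ≈ q [mod M ] → q ≈ r [mod M ] → p ≈ r [mod M ]
  mod-trans {r = r} (congruent Q e) (congruent Q′ e′) = congruent (Q′ ⊕ Q)
    (e ⟨≈⟩ ⊕-congʳ (M ⊛ Q) e′ ⟨≈⟩
     solve 4 (λ r M Q Q′ → (r :+ M :* Q′) :+ M :* Q := r :+ M :* (Q′ :+ Q)) ≈-refl r M Q Q′)

  mod-⊕-cong : ∀ {p p′ q q′} → p ≈ p′ [mod M ] → q ≈ q′ [mod M ] → p ⊕ q ≈ p′ ⊕ q′ [mod M ]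
  mod-⊕-cong {p′ = p′} {q′ = q′} (congruent Q e) (congruent Q′ e′) = congruent (Q ⊕ Q′)
    (⊕-cong e e′ ⟨≈⟩
     solve 5 (λ p q M Q Q′ → (p :+ M :* Q) :+ (q :+ M :* Q′) := (p :+ q) :+ M :* (Q :+ Q′)) ≈-refl p′ q′ M Q Q′)

  mod-⊛-cong : ∀ {p p′ q q′} → p ≈ p′ [mod M ] → q ≈ q′ [mod M ] → p ⊛ q ≈ p′ ⊛ q′ [mod M ]
  mod-⊛-cong {p′ = p′} {q′ = q′} (congruent Q e) (congruent Q′ e′) =
    congruent (p′ ⊛ Q′ ⊕ Q ⊛ q′ ⊕ M ⊛ Q ⊛ Q′)
    (⊛-cong e e′ ⟨≈⟩
     solve 5 (λ p q M Q Q′ → (p :+ M :* Q) :* (q :+ M :* Q′)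
                             := p :* q :+ M :* (p :* Q′ :+ Q :* q :+ M :* Q :* Q′)) ≈-refl p′ q′ M Q Q′)

  modulus≈0 : M ≈ [] [mod M ]
  modulus≈0 = congruent (const (+ 1)) (≈-sym (⊛-comm M (const (+ 1)) ⟨≈⟩ ⊛-identityˡ M))

modulo : Poly → PolyCongruence
modulo M = record
  { _∼_ = _≈_[mod M ]
  ; isEquivalence = record { refl = ≈⇒≈mod ≈-refl ; sym = mod-sym ; trans = mod-trans }
  ; ≈⇒∼ = ≈⇒≈mod
  ; +-cong = mod-⊕-cong
  ; *-cong = mod-⊛-cong }

mod-cong-modulus : ∀ {M M′ p q} → M ≈ M′ → p ≈ q [mod M ] → p ≈ q [mod M′ ]
mod-cong-modulus {q = q} M≈M′ (congruent Q e) = congruent Q (e ⟨≈⟩ ⊕-congˡ q (⊛-congʳ Q M≈M′))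

∘-zero : ∀ {p} r → p ≈ [] → p ∘ₚ r ≈ []
∘-zero {[]}    r p≈0 = ≈-refl
∘-zero {a ∷ p} r p≈0 =
  ⊕-cong (∷-cong (coeff-≡ p≈0 zero) ≈-refl ⟨≈⟩ ≈-sym []≈0∷[])
         (⊛-congˡ r (∘-zero {p} r (coeffwise λ n → coeff-≡ p≈0 (suc n))) ⟨≈⟩ ⊛-zeroʳ r)

∘-congʳ : ∀ {p p′} r → p ≈ p′ → p ∘ₚ r ≈ p′ ∘ₚ r
∘-congʳ {[]}    {[]}     r e = ≈-refl
∘-congʳ {[]}    {b ∷ p′} r e = ≈-sym (∘-zero r (≈-sym e))
∘-congʳ {a ∷ p} {[]}     r e = ∘-zero r e
∘-congʳ {a ∷ p} {b ∷ p′} r e rewrite ∷-injectiveˡ e =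
  ⊕-cong ≈-refl (⊛-congˡ r (∘-congʳ r (∷-injectiveʳ e)))

∘-const : ∀ a r → const a ∘ₚ r ≈ const a
∘-const a r = ⊕-cong (≈-refl {const a}) (⊛-zeroʳ r) ⟨≈⟩ ⊕-identityʳ (const a)

∘-X : ∀ r → X ∘ₚ r ≈ r
∘-X r = ⊕-cong (≈-sym []≈0∷[]) (⊛-congˡ r (∘-const (+ 1) r)) ⟨≈⟩ ⊛-comm r (const (+ 1)) ⟨≈⟩ ⊛-identityˡ r

∘-⊕ : ∀ p q r → (p ⊕ q) ∘ₚ r ≈ p ∘ₚ r ⊕ q ∘ₚ r
∘-⊕ []      q       r = ≈-refl
∘-⊕ (a ∷ p) []      r = ≈-sym (⊕-identityʳ _)
∘-⊕ (a ∷ p) (b ∷ q) r =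
  ⊕-cong (≈-refl {const (a + b)}) (⊛-congˡ r (∘-⊕ p q r)) ⟨≈⟩
  solve 5 (λ A B R P Q → (A :+ B) :+ R :* (P :+ Q) := (A :+ R :* P) :+ (B :+ R :* Q)) ≈-refl
    (const a) (const b) r (p ∘ₚ r) (q ∘ₚ r)

∘-· : ∀ c p r → (c · p) ∘ₚ r ≈ c · (p ∘ₚ r)
∘-· c []      r = ≈-refl
∘-· c (a ∷ p) r =
  ⊕-cong (∷-cong (sym (ℤₚ.+-identityʳ (c * a))) ≈-refl) (⊛-congˡ r (∘-· c p r ⟨≈⟩ ·≈const⊛ c (p ∘ₚ r))) ⟨≈⟩
  solve 4 (λ C A R P → C :* A :+ R :* (C :* P) := C :* (A :+ R :* P)) ≈-refl
    (const c) (const a) r (p ∘ₚ r)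
  ⟨≈⟩ ≈-sym (·≈const⊛ c _)

∘-⊛ : ∀ p q r → (p ⊛ q) ∘ₚ r ≈ (p ∘ₚ r) ⊛ (q ∘ₚ r)
∘-⊛ []      q r = ≈-refl
∘-⊛ (a ∷ p) q r =
  ∘-⊕ (a · q) (+ 0 ∷ (p ⊛ q)) r ⟨≈⟩
  ⊕-cong (∘-· a q r ⟨≈⟩ ·≈const⊛ a (q ∘ₚ r)) (⊕-cong (≈-sym []≈0∷[]) (⊛-congˡ r (∘-⊛ p q r))) ⟨≈⟩
  solve 4 (λ A R P Q → A :* Q :+ R :* (P :* Q) := (A :+ R :* P) :* Q) ≈-refl
    (const a) r (p ∘ₚ r) (q ∘ₚ r)

∘-^ : ∀ p n r → (p ^ₚ n) ∘ₚ r ≈ (p ∘ₚ r) ^ₚ n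
∘-^ p zero    r = ∘-const (+ 1) r
∘-^ p (suc n) r = ∘-⊛ p (p ^ₚ n) r ⟨≈⟩ ⊛-congˡ (p ∘ₚ r) (∘-^ p n r)

∘-assoc : ∀ p q r → (p ∘ₚ q) ∘ₚ r ≈ p ∘ₚ (q ∘ₚ r)
∘-assoc []      q r = ≈-refl
∘-assoc (a ∷ p) q r =
  ∘-⊕ (const a) (q ⊛ (p ∘ₚ q)) r ⟨≈⟩
  ⊕-cong (∘-const a r) (∘-⊛ q (p ∘ₚ q) r ⟨≈⟩ ⊛-congˡ (q ∘ₚ r) (∘-assoc p q r))

X^-∘ : ∀ n r → (X ^ₚ n) ∘ₚ r ≈ r ^ₚ n
X^-∘ n r = ∘-^ X n r ⟨≈⟩ ℤ[X].^-cong n (∘-X r)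

X^-∘-X^ : ∀ m n → (X ^ₚ m) ∘ₚ (X ^ₚ n) ≈ X ^ₚ (n ℕ.* m)
X^-∘-X^ m n = X^-∘ m (X ^ₚ n) ⟨≈⟩ ≈-sym (^-* X n m)

at1-⊕ : ∀ p q → at1 (p ⊕ q) ≡ at1 p + at1 q
at1-⊕ []      q       = sym (ℤₚ.+-identityˡ (at1 q))
at1-⊕ (a ∷ p) []      = sym (ℤₚ.+-identityʳ _)
at1-⊕ (a ∷ p) (b ∷ q) = trans (cong (λ z → a + b + z) (at1-⊕ p q)) (interchange a b (at1 p) (at1 q))
  where
  interchange : ∀ a b x y → a + b + (x + y) ≡ a + x + (b + y)
  interchange = solve-∀

at1-· : ∀ c p → at1 (c · p) ≡ c * at1 p
at1-· c []      = sym (ℤₚ.*-zeroʳ c)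
at1-· c (a ∷ p) = trans (cong (λ z → c * a + z) (at1-· c p)) (sym (ℤₚ.*-distribˡ-+ c a (at1 p)))

at1-⊛ : ∀ p q → at1 (p ⊛ q) ≡ at1 p * at1 q
at1-⊛ []      q = refl
at1-⊛ (a ∷ p) q = begin
  at1 (a · q ⊕ (+ 0 ∷ p ⊛ q))        ≡⟨ at1-⊕ (a · q) (+ 0 ∷ (p ⊛ q)) ⟩
  at1 (a · q) + (+ 0 + at1 (p ⊛ q))  ≡⟨ cong₂ (λ x y → x + (+ 0 + y)) (at1-· a q) (at1-⊛ p q) ⟩
  a * at1 q + (+ 0 + at1 p * at1 q)  ≡⟨ distrib a (at1 p) (at1 q) ⟩
  (a + at1 p) * at1 q                ∎
  where
  open ≡-Reasoning
  distrib : ∀ a x y → a * y + (+ 0 + x * y) ≡ (a + x) * y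
  distrib = solve-∀

at1-^ : ∀ p n → at1 (p ^ₚ n) ≡ at1 p ^ n
at1-^ p zero    = refl
at1-^ p (suc n) = trans (at1-⊛ p (p ^ₚ n)) (cong (at1 p *_) (at1-^ p n))

at1-cong : ∀ {p q} → p ≈ q → at1 p ≡ at1 q
at1-cong {[]}    {[]}    e = refl
at1-cong {[]}    {b ∷ q} e = cong₂ _+_ (coeff-≡ e zero) (at1-cong {[]} {q} (coeffwise λ n → coeff-≡ e (suc n)))
at1-cong {a ∷ p} {[]}    e = cong₂ _+_ (coeff-≡ e zero) (at1-cong {p} {[]} (coeffwise λ n → coeff-≡ e (suc n)))
at1-cong {a ∷ p} {b ∷ q} e = cong₂ _+_ (∷-injectiveˡ e) (at1-cong (∷-injectiveʳ e))

at1-∘ : ∀ p {q} → at1 q ≡ + 1 → at1 (p ∘ₚ q) ≡ at1 p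
at1-∘ []      q₁≡1 = refl
at1-∘ (a ∷ p) {q} q₁≡1 = begin
  at1 (const a ⊕ q ⊛ (p ∘ₚ q))  ≡⟨ at1-⊕ (const a) (q ⊛ (p ∘ₚ q)) ⟩
  a + + 0 + at1 (q ⊛ (p ∘ₚ q))  ≡⟨ cong₂ _+_ (ℤₚ.+-identityʳ a) (at1-⊛ q (p ∘ₚ q)) ⟩
  a + at1 q * at1 (p ∘ₚ q)      ≡⟨ cong₂ (λ x y → a + x * y) q₁≡1 (at1-∘ p q₁≡1) ⟩
  a + + 1 * at1 p               ≡⟨ cong (λ z → a + z) (ℤₚ.*-identityˡ (at1 p)) ⟩
  a + at1 p                     ∎
  where open ≡-Reasoning

-- ℤ[X] over ℤ[X³]

X³ : Poly
X³ = X ^ₚ 3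

-- (a , b , c) stands for a(X³) + X b(X³) + X² c(X³): ℤ[X] as a free ℤ[X³]-module.
Split : Set
Split = Poly × Poly × Poly

⟦_⟧ : Split → Poly
⟦ a , b , c ⟧ = a ∘ₚ X³ ⊕ X ⊛ (b ∘ₚ X³) ⊕ X ^ₚ 2 ⊛ (c ∘ₚ X³)

ι₃ : Poly → Split
ι₃ a = a , [] , []

infixl 6 _⊕₃_
infixl 7 _⊛₃_

_⊕₃_ : Split → Split → Split
(a₀ , a₁ , a₂) ⊕₃ (b₀ , b₁ , b₂) = a₀ ⊕ b₀ , a₁ ⊕ b₁ , a₂ ⊕ b₂

_⊛₃_ : Split → Split → Split
(a₀ , a₁ , a₂) ⊛₃ (b₀ , b₁ , b₂) =
  a₀ ⊛ b₀ ⊕ X ⊛ (a₁ ⊛ b₂ ⊕ a₂ ⊛ b₁) ,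
  a₀ ⊛ b₁ ⊕ a₁ ⊛ b₀ ⊕ X ⊛ (a₂ ⊛ b₂) ,
  a₀ ⊛ b₂ ⊕ a₁ ⊛ b₁ ⊕ a₂ ⊛ b₀

split : Poly → Split
split []      = [] , [] , []
split (a ∷ p) = rotate (split p)
  where
  rotate : Split → Split
  rotate (q₀ , q₁ , q₂) = a ∷ q₂ , q₀ , q₁

X⊛ : ∀ p → X ⊛ p ≈ + 0 ∷ p
X⊛ p = ⊕-cong (0·-zero p) (∷-cong refl (⊛-identityˡ p))

∷≈const⊕X⊛ : ∀ a p → a ∷ p ≈ const a ⊕ X ⊛ p
∷≈const⊕X⊛ a p = ∷-split a p ⟨≈⟩ ⊕-congˡ (const a) (≈-sym (X⊛ p))

⟦⟧-cong : ∀ {a b c a′ b′ c′} → a ≈ a′ → b ≈ b′ → c ≈ c′ → ⟦ a , b , c ⟧ ≈ ⟦ a′ , b′ , c′ ⟧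
⟦⟧-cong a≈a′ b≈b′ c≈c′ =
  ⊕-cong (⊕-cong (∘-congʳ X³ a≈a′) (⊛-congˡ X (∘-congʳ X³ b≈b′))) (⊛-congˡ (X ^ₚ 2) (∘-congʳ X³ c≈c′))

⟦split⟧ : ∀ p → ⟦ split p ⟧ ≈ p
⟦split⟧ []      = ⊕-cong (⊛-zeroʳ X) (⊛-zeroʳ (X ^ₚ 2))
⟦split⟧ (a ∷ p) =
  solve 5 (λ x A Q₀ Q₁ Q₂ → (A :+ x :^ 3 :* Q₂) :+ x :* Q₀ :+ x :^ 2 :* Q₁
                          := A :+ x :* (Q₀ :+ x :* Q₁ :+ x :^ 2 :* Q₂)) ≈-refl
    X (const a) (q₀ ∘ₚ X³) (q₁ ∘ₚ X³) (q₂ ∘ₚ X³)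
  ⟨≈⟩ ⊕-congˡ (const a) (⊛-congˡ X (⟦split⟧ p))
  ⟨≈⟩ ≈-sym (∷≈const⊕X⊛ a p)
  where
  q₀ = proj₁ (split p)
  q₁ = proj₁ (proj₂ (split p))
  q₂ = proj₂ (proj₂ (split p))

shift : Poly → Poly
shift []      = []
shift (_ ∷ p) = p

coeff-shift : ∀ p n → coeff (shift p) n ≡ coeff p (suc n)
coeff-shift []      n = refl
coeff-shift (a ∷ p) n = refl

≈∷shift : ∀ p → p ≈ coeff p 0 ∷ shift p
≈∷shift []      = []≈0∷[]
≈∷shift (a ∷ p) = ≈-refl

⟦⟧-unfold : ∀ a b c → ⟦ a , b , c ⟧ ≈ coeff a 0 ∷ coeff b 0 ∷ coeff c 0 ∷ ⟦ shift a , shift b , shift c ⟧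
⟦⟧-unfold a b c =
  ⟦⟧-cong (≈∷shift a) (≈∷shift b) (≈∷shift c)
  ⟨≈⟩ solve 7 (λ x A B C A′ B′ C′ →
        (A :+ x :^ 3 :* A′) :+ x :* (B :+ x :^ 3 :* B′) :+ x :^ 2 :* (C :+ x :^ 3 :* C′)
        := A :+ x :* (B :+ x :* (C :+ x :* (A′ :+ x :* B′ :+ x :^ 2 :* C′)))) ≈-refl
      X (const (coeff a 0)) (const (coeff b 0)) (const (coeff c 0))
      (shift a ∘ₚ X³) (shift b ∘ₚ X³) (shift c ∘ₚ X³)
  ⟨≈⟩ ≈-sym (∷≈const⊕X⊛ a₀ (b₀ ∷ c₀ ∷ rest)
             ⟨≈⟩ ⊕-congˡ (const a₀) (⊛-congˡ X (∷≈const⊕X⊛ b₀ (c₀ ∷ rest)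
             ⟨≈⟩ ⊕-congˡ (const b₀) (⊛-congˡ X (∷≈const⊕X⊛ c₀ rest)))))
  where
  a₀ = coeff a 0
  b₀ = coeff b 0
  c₀ = coeff c 0
  rest = ⟦ shift a , shift b , shift c ⟧

coeff-⟦⟧ : ∀ a b c n → coeff ⟦ a , b , c ⟧ (n ℕ.* 3) ≡ coeff a n
coeff-⟦⟧ a b c zero    = coeff-≡ (⟦⟧-unfold a b c) 0
coeff-⟦⟧ a b c (suc n) = begin
  coeff ⟦ a , b , c ⟧ (suc n ℕ.* 3)                ≡⟨ coeff-≡ (⟦⟧-unfold a b c) (suc n ℕ.* 3) ⟩
  coeff ⟦ shift a , shift b , shift c ⟧ (n ℕ.* 3)  ≡⟨ coeff-⟦⟧ (shift a) (shift b) (shift c) n ⟩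
  coeff (shift a) n                                ≡⟨ coeff-shift a n ⟩
  coeff a (suc n)                                  ∎
  where open ≡-Reasoning

⟦⟧-injective₀ : ∀ s t → ⟦ s ⟧ ≈ ⟦ t ⟧ → proj₁ s ≈ proj₁ t
⟦⟧-injective₀ (a , b , c) (a′ , b′ , c′) e = coeffwise λ n →
  trans (sym (coeff-⟦⟧ a b c n)) (trans (coeff-≡ e (n ℕ.* 3)) (coeff-⟦⟧ a′ b′ c′ n))

⟦ι₃⟧ : ∀ a → ⟦ ι₃ a ⟧ ≈ a ∘ₚ X³
⟦ι₃⟧ a = ⊕-cong (⊕-congˡ (a ∘ₚ X³) (⊛-zeroʳ X)) (⊛-zeroʳ (X ^ₚ 2))
  ⟨≈⟩ ⊕-identityʳ (a ∘ₚ X³ ⊕ []) ⟨≈⟩ ⊕-identityʳ (a ∘ₚ X³)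

⟦⟧-⊕₃ : ∀ s t → ⟦ s ⊕₃ t ⟧ ≈ ⟦ s ⟧ ⊕ ⟦ t ⟧
⟦⟧-⊕₃ (a₀ , a₁ , a₂) (b₀ , b₁ , b₂) =
  ⊕-cong (⊕-cong (∘-⊕ a₀ b₀ X³) (⊛-congˡ X (∘-⊕ a₁ b₁ X³))) (⊛-congˡ (X ^ₚ 2) (∘-⊕ a₂ b₂ X³))
  ⟨≈⟩ solve 7 (λ x A₀ A₁ A₂ B₀ B₁ B₂ →
        (A₀ :+ B₀) :+ x :* (A₁ :+ B₁) :+ x :^ 2 :* (A₂ :+ B₂)
        := (A₀ :+ x :* A₁ :+ x :^ 2 :* A₂) :+ (B₀ :+ x :* B₁ :+ x :^ 2 :* B₂)) ≈-refl
      X (a₀ ∘ₚ X³) (a₁ ∘ₚ X³) (a₂ ∘ₚ X³) (b₀ ∘ₚ X³) (b₁ ∘ₚ X³) (b₂ ∘ₚ X³)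

⟦⟧-⊛₃ : ∀ s t → ⟦ s ⊛₃ t ⟧ ≈ ⟦ s ⟧ ⊛ ⟦ t ⟧
⟦⟧-⊛₃ (a₀ , a₁ , a₂) (b₀ , b₁ , b₂) =
  ⊕-cong (⊕-cong image₀ (⊛-congˡ X image₁)) (⊛-congˡ (X ^ₚ 2) image₂)
  ⟨≈⟩ solve 7 (λ x A₀ A₁ A₂ B₀ B₁ B₂ →
        (A₀ :* B₀ :+ x :^ 3 :* (A₁ :* B₂ :+ A₂ :* B₁))
          :+ x :* (A₀ :* B₁ :+ A₁ :* B₀ :+ x :^ 3 :* (A₂ :* B₂))
          :+ x :^ 2 :* (A₀ :* B₂ :+ A₁ :* B₁ :+ A₂ :* B₀)
        := (A₀ :+ x :* A₁ :+ x :^ 2 :* A₂) :* (B₀ :+ x :* B₁ :+ x :^ 2 :* B₂)) ≈-refl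
      X A₀ A₁ A₂ B₀ B₁ B₂
  where
  A₀ = a₀ ∘ₚ X³
  A₁ = a₁ ∘ₚ X³
  A₂ = a₂ ∘ₚ X³
  B₀ = b₀ ∘ₚ X³
  B₁ = b₁ ∘ₚ X³
  B₂ = b₂ ∘ₚ X³
  ∘X³-⊛ : ∀ p q → (p ⊛ q) ∘ₚ X³ ≈ (p ∘ₚ X³) ⊛ (q ∘ₚ X³)
  ∘X³-⊛ p q = ∘-⊛ p q X³
  ∘X³-X⊛ : ∀ p → (X ⊛ p) ∘ₚ X³ ≈ X³ ⊛ (p ∘ₚ X³)
  ∘X³-X⊛ p = ∘-⊛ X p X³ ⟨≈⟩ ⊛-congʳ (p ∘ₚ X³) (∘-X X³)
  ∘X³-sum : ∀ p q r → (p ⊛ q ⊕ r) ∘ₚ X³ ≈ (p ∘ₚ X³) ⊛ (q ∘ₚ X³) ⊕ r ∘ₚ X³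
  ∘X³-sum p q r = ∘-⊕ (p ⊛ q) r X³ ⟨≈⟩ ⊕-congʳ (r ∘ₚ X³) (∘X³-⊛ p q)
  image₀ : (a₀ ⊛ b₀ ⊕ X ⊛ (a₁ ⊛ b₂ ⊕ a₂ ⊛ b₁)) ∘ₚ X³ ≈ A₀ ⊛ B₀ ⊕ X³ ⊛ (A₁ ⊛ B₂ ⊕ A₂ ⊛ B₁)
  image₀ = ∘X³-sum a₀ b₀ (X ⊛ (a₁ ⊛ b₂ ⊕ a₂ ⊛ b₁))
    ⟨≈⟩ ⊕-congˡ (A₀ ⊛ B₀) (∘X³-X⊛ (a₁ ⊛ b₂ ⊕ a₂ ⊛ b₁)
    ⟨≈⟩ ⊛-congˡ X³ (∘X³-sum a₁ b₂ (a₂ ⊛ b₁) ⟨≈⟩ ⊕-congˡ (A₁ ⊛ B₂) (∘X³-⊛ a₂ b₁)))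
  image₁ : (a₀ ⊛ b₁ ⊕ a₁ ⊛ b₀ ⊕ X ⊛ (a₂ ⊛ b₂)) ∘ₚ X³ ≈ A₀ ⊛ B₁ ⊕ A₁ ⊛ B₀ ⊕ X³ ⊛ (A₂ ⊛ B₂)
  image₁ = ∘-⊕ (a₀ ⊛ b₁ ⊕ a₁ ⊛ b₀) (X ⊛ (a₂ ⊛ b₂)) X³
    ⟨≈⟩ ⊕-cong (∘X³-sum a₀ b₁ (a₁ ⊛ b₀) ⟨≈⟩ ⊕-congˡ (A₀ ⊛ B₁) (∘X³-⊛ a₁ b₀))
               (∘X³-X⊛ (a₂ ⊛ b₂) ⟨≈⟩ ⊛-congˡ X³ (∘X³-⊛ a₂ b₂))
  image₂ : (a₀ ⊛ b₂ ⊕ a₁ ⊛ b₁ ⊕ a₂ ⊛ b₀) ∘ₚ X³ ≈ A₀ ⊛ B₂ ⊕ A₁ ⊛ B₁ ⊕ A₂ ⊛ B₀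
  image₂ = ∘-⊕ (a₀ ⊛ b₂ ⊕ a₁ ⊛ b₁) (a₂ ⊛ b₀) X³
    ⟨≈⟩ ⊕-cong (∘X³-sum a₀ b₂ (a₁ ⊛ b₁) ⟨≈⟩ ⊕-congˡ (A₀ ⊛ B₂) (∘X³-⊛ a₁ b₁)) (∘X³-⊛ a₂ b₀)

normForm : Poly → Poly → Poly → Poly → Poly
normForm u a b c = a ^ₚ 3 ⊕ u ⊛ b ^ₚ 3 ⊕ u ^ₚ 2 ⊛ c ^ₚ 3 ⊟ const (+ 3) ⊛ u ⊛ a ⊛ b ⊛ c

-- The norm from ℤ[X] down to ℤ[X³], written in the variable X³ ↦ X.
norm₃ : Split → Poly
norm₃ (a , b , c) = normForm X a b c

-- (e₁ + e₂)/3, where e₁ = 3a and e₂ = 3(a² − X b c) are the elementary symmetric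
-- functions of the three conjugates of a(X³) + X b(X³) + X² c(X³).
traceTerm : Split → Poly
traceTerm (a , b , c) = a ⊕ a ⊛ a ⊟ X ⊛ b ⊛ c

norm₃-⊛₃ : ∀ s t → norm₃ (s ⊛₃ t) ≈ norm₃ s ⊛ norm₃ t
norm₃-⊛₃ (a₀ , a₁ , a₂) (b₀ , b₁ , b₂) =
  solve 7 (λ x a₀ a₁ a₂ b₀ b₁ b₂ →
    let N = λ a b c → a :^ 3 :+ x :* b :^ 3 :+ x :^ 2 :* c :^ 3 :- con (+ 3) :* x :* a :* b :* c
    in N (a₀ :* b₀ :+ x :* (a₁ :* b₂ :+ a₂ :* b₁)) (a₀ :* b₁ :+ a₁ :* b₀ :+ x :* (a₂ :* b₂))
         (a₀ :* b₂ :+ a₁ :* b₁ :+ a₂ :* b₀)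
       := N a₀ a₁ a₂ :* N b₀ b₁ b₂) ≈-refl X a₀ a₁ a₂ b₀ b₁ b₂

norm₃-1+ : ∀ s → norm₃ (ι₃ (const (+ 1)) ⊕₃ s) ≈ const (+ 1) ⊕ const (+ 3) ⊛ traceTerm s ⊕ norm₃ s
norm₃-1+ (a , b , c) =
  solve 4 (λ x a b c →
    let N = λ a b c → a :^ 3 :+ x :* b :^ 3 :+ x :^ 2 :* c :^ 3 :- con (+ 3) :* x :* a :* b :* c
    in N (con (+ 1) :+ a) b c := con (+ 1) :+ con (+ 3) :* (a :+ a :* a :- x :* b :* c) :+ N a b c)
    ≈-refl X a b c

normForm-∘ : ∀ u a b c r → normForm u a b c ∘ₚ r ≈ normForm (u ∘ₚ r) (a ∘ₚ r) (b ∘ₚ r) (c ∘ₚ r)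
normForm-∘ u a b c r =
  ∘-⊕ (a ^ₚ 3 ⊕ u ⊛ b ^ₚ 3 ⊕ u ^ₚ 2 ⊛ c ^ₚ 3) (neg (const (+ 3) ⊛ u ⊛ a ⊛ b ⊛ c)) r ⟨≈⟩
  ⊕-cong (∘-⊕ (a ^ₚ 3 ⊕ u ⊛ b ^ₚ 3) (u ^ₚ 2 ⊛ c ^ₚ 3) r ⟨≈⟩
           ⊕-cong (∘-⊕ (a ^ₚ 3) (u ⊛ b ^ₚ 3) r
                   ⟨≈⟩ ⊕-cong (∘-^ a 3 r) (∘-⊛ u (b ^ₚ 3) r ⟨≈⟩ ⊛-congˡ (u ∘ₚ r) (∘-^ b 3 r)))
                  (∘-⊛ (u ^ₚ 2) (c ^ₚ 3) r ⟨≈⟩ ⊛-cong (∘-^ u 2 r) (∘-^ c 3 r)))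
         (∘-· (- + 1) (const (+ 3) ⊛ u ⊛ a ⊛ b ⊛ c) r ⟨≈⟩ ·-congˡ (- + 1)
           (∘-⊛ (const (+ 3) ⊛ u ⊛ a ⊛ b) c r ⟨≈⟩ ⊛-congʳ (c ∘ₚ r)
             (∘-⊛ (const (+ 3) ⊛ u ⊛ a) b r ⟨≈⟩ ⊛-congʳ (b ∘ₚ r)
               (∘-⊛ (const (+ 3) ⊛ u) a r ⟨≈⟩ ⊛-congʳ (a ∘ₚ r)
                 (∘-⊛ (const (+ 3)) u r ⟨≈⟩ ⊛-congʳ (u ∘ₚ r) (∘-const (+ 3) r))))))

at1-⟦⟧ : ∀ a b c → at1 ⟦ a , b , c ⟧ ≡ at1 a + at1 b + at1 c
at1-⟦⟧ a b c = begin
  at1 ⟦ a , b , c ⟧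
    ≡⟨ at1-⊕ (A ⊕ X ⊛ B) (X ^ₚ 2 ⊛ C) ⟩
  at1 (A ⊕ X ⊛ B) + at1 (X ^ₚ 2 ⊛ C)
    ≡⟨ cong₂ _+_ (at1-⊕ A (X ⊛ B)) (at1-⊛ (X ^ₚ 2) C) ⟩
  at1 A + at1 (X ⊛ B) + + 1 * at1 C
    ≡⟨ cong₂ (λ x y → at1 A + x + y) (trans (at1-⊛ X B) (ℤₚ.*-identityˡ (at1 B))) (ℤₚ.*-identityˡ (at1 C)) ⟩
  at1 A + at1 B + at1 C
    ≡⟨ cong₂ _+_ (cong₂ _+_ (at1-∘ a refl) (at1-∘ b refl)) (at1-∘ c refl) ⟩
  at1 a + at1 b + at1 c
    ∎
  where
  open ≡-Reasoning
  A = a ∘ₚ X³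
  B = b ∘ₚ X³
  C = c ∘ₚ X³

at1-normForm : ∀ u a b c → at1 (normForm u a b c) ≡
  at1 a ^ 3 + at1 u * at1 b ^ 3 + at1 u ^ 2 * at1 c ^ 3 + - + 1 * (+ 3 * at1 u * at1 a * at1 b * at1 c)
at1-normForm u a b c = begin
  at1 (normForm u a b c)
    ≡⟨ at1-⊕ (a ^ₚ 3 ⊕ u ⊛ b ^ₚ 3 ⊕ u ^ₚ 2 ⊛ c ^ₚ 3) (neg (const (+ 3) ⊛ u ⊛ a ⊛ b ⊛ c)) ⟩
  at1 (a ^ₚ 3 ⊕ u ⊛ b ^ₚ 3 ⊕ u ^ₚ 2 ⊛ c ^ₚ 3) + at1 (neg (const (+ 3) ⊛ u ⊛ a ⊛ b ⊛ c))
    ≡⟨ cong₂ _+_ cubes (trans (at1-· (- + 1) (const (+ 3) ⊛ u ⊛ a ⊛ b ⊛ c)) (cong (- + 1 *_) product)) ⟩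
  at1 a ^ 3 + at1 u * at1 b ^ 3 + at1 u ^ 2 * at1 c ^ 3 + - + 1 * (+ 3 * at1 u * at1 a * at1 b * at1 c)
    ∎
  where
  open ≡-Reasoning
  cubes : at1 (a ^ₚ 3 ⊕ u ⊛ b ^ₚ 3 ⊕ u ^ₚ 2 ⊛ c ^ₚ 3) ≡ at1 a ^ 3 + at1 u * at1 b ^ 3 + at1 u ^ 2 * at1 c ^ 3
  cubes = begin
    at1 (a ^ₚ 3 ⊕ u ⊛ b ^ₚ 3 ⊕ u ^ₚ 2 ⊛ c ^ₚ 3)
      ≡⟨ at1-⊕ (a ^ₚ 3 ⊕ u ⊛ b ^ₚ 3) (u ^ₚ 2 ⊛ c ^ₚ 3) ⟩
    at1 (a ^ₚ 3 ⊕ u ⊛ b ^ₚ 3) + at1 (u ^ₚ 2 ⊛ c ^ₚ 3)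
      ≡⟨ cong₂ _+_ (at1-⊕ (a ^ₚ 3) (u ⊛ b ^ₚ 3)) (at1-⊛ (u ^ₚ 2) (c ^ₚ 3)) ⟩
    at1 (a ^ₚ 3) + at1 (u ⊛ b ^ₚ 3) + at1 (u ^ₚ 2) * at1 (c ^ₚ 3)
      ≡⟨ cong₂ _+_ (cong₂ _+_ (at1-^ a 3) (trans (at1-⊛ u (b ^ₚ 3)) (cong (at1 u *_) (at1-^ b 3))))
                   (cong₂ _*_ (at1-^ u 2) (at1-^ c 3)) ⟩
    at1 a ^ 3 + at1 u * at1 b ^ 3 + at1 u ^ 2 * at1 c ^ 3
      ∎
  product : at1 (const (+ 3) ⊛ u ⊛ a ⊛ b ⊛ c) ≡ + 3 * at1 u * at1 a * at1 b * at1 c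
  product = begin
    at1 (const (+ 3) ⊛ u ⊛ a ⊛ b ⊛ c)              ≡⟨ at1-⊛ (const (+ 3) ⊛ u ⊛ a ⊛ b) c ⟩
    at1 (const (+ 3) ⊛ u ⊛ a ⊛ b) * at1 c          ≡⟨ cong (_* at1 c) (at1-⊛ (const (+ 3) ⊛ u ⊛ a) b) ⟩
    at1 (const (+ 3) ⊛ u ⊛ a) * at1 b * at1 c      ≡⟨ cong (λ x → x * at1 b * at1 c) (at1-⊛ (const (+ 3) ⊛ u) a) ⟩
    at1 (const (+ 3) ⊛ u) * at1 a * at1 b * at1 c  ≡⟨ cong (λ x → x * at1 a * at1 b * at1 c) (at1-⊛ (const (+ 3)) u) ⟩
    + 3 * at1 u * at1 a * at1 b * at1 c            ∎

at1-norm₃ : ∀ a b c → let s = at1 a + at1 b + at1 c in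
  at1 (norm₃ (a , b , c)) ≡ s ^ 3 + + 3 * (- (s * (at1 a * at1 b + at1 b * at1 c + at1 c * at1 a)))
at1-norm₃ a b c = trans (at1-normForm X a b c) (sum-of-cubes (at1 a) (at1 b) (at1 c))
  where
  sum-of-cubes : ∀ α β γ →
    α * (α * (α * + 1)) + + 1 * (β * (β * (β * + 1))) + + 1 * (+ 1 * + 1) * (γ * (γ * (γ * + 1)))
      + - + 1 * (+ 3 * + 1 * α * β * γ)
    ≡ (α + β + γ) * ((α + β + γ) * ((α + β + γ) * + 1)) + + 3 * (- ((α + β + γ) * (α * β + β * γ + γ * α)))
  sum-of-cubes = solve-∀

normForm-congˡ : ∀ {u u′} a b c → u ≈ u′ → normForm u a b c ≈ normForm u′ a b c
normForm-congˡ a b c u≈u′ =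
  ⊕-cong (⊕-cong (⊕-congˡ (a ^ₚ 3) (⊛-congʳ (b ^ₚ 3) u≈u′)) (⊛-congʳ (c ^ₚ 3) (ℤ[X].^-cong 2 u≈u′)))
         (·-congˡ (- + 1) (⊛-congʳ c (⊛-congʳ b (⊛-congʳ a (⊛-congˡ (const (+ 3)) u≈u′)))))

⟦⟧-∘ : ∀ a b c r → ⟦ a , b , c ⟧ ∘ₚ r ≈ a ∘ₚ (r ^ₚ 3) ⊕ r ⊛ (b ∘ₚ (r ^ₚ 3)) ⊕ r ^ₚ 2 ⊛ (c ∘ₚ (r ^ₚ 3))
⟦⟧-∘ a b c r =
  ∘-⊕ (a ∘ₚ X³ ⊕ X ⊛ (b ∘ₚ X³)) (X ^ₚ 2 ⊛ (c ∘ₚ X³)) r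
  ⟨≈⟩ ⊕-cong (∘-⊕ (a ∘ₚ X³) (X ⊛ (b ∘ₚ X³)) r
              ⟨≈⟩ ⊕-cong (∘X³-∘ a) (∘-⊛ X (b ∘ₚ X³) r ⟨≈⟩ ⊛-cong (∘-X r) (∘X³-∘ b)))
             (∘-⊛ (X ^ₚ 2) (c ∘ₚ X³) r ⟨≈⟩ ⊛-cong (X^-∘ 2 r) (∘X³-∘ c))
  where
  ∘X³-∘ : ∀ p → (p ∘ₚ X³) ∘ₚ r ≈ p ∘ₚ (r ^ₚ 3)
  ∘X³-∘ p = ∘-assoc p X³ r ⟨≈⟩ ℤ[X].∘-congˡ p (X^-∘ 3 r)

open IsEquivalence (⇔-isEquivalence {ℓ = 0ℓ}) using () renaming (refl to ⇔-refl; trans to ⇔-trans)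

≡⇒⇔∣ : ∀ d {m n} → m ≡ n → (d ∣ m) ⇔ (d ∣ n)
≡⇒⇔∣ d {m} refl = ⇔-refl {x = d ∣ m}

∣m+d*k⇔∣m : ∀ d m k → (d ∣ m + d * k) ⇔ (d ∣ m)
∣m+d*k⇔∣m d m k = mk⇔
  (λ d∣m+dk → Signed.∣⇒∣ᵤ (Signed.∣m+n∣n⇒∣m {m = m} (Signed.∣ᵤ⇒∣ {i = m + d * k} d∣m+dk) d∣dk))
  (λ d∣m → Signed.∣⇒∣ᵤ (Signed.∣m∣n⇒∣m+n (Signed.∣ᵤ⇒∣ {i = m} d∣m) d∣dk))
  where
  d∣dk : d Signed.∣ d * k
  d∣dk = Signed.∣m⇒∣m*n k Signed.∣-refl

prime∣^⇔∣ : ∀ {p} → Prime p → ∀ n k → (+ p ∣ n ^ suc k) ⇔ (+ p ∣ n)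
prime∣^⇔∣ {p} p-prime n k = mk⇔ (to k) (λ p∣n → subst (p ℕᵈ.∣_) (sym (ℤₚ.abs-* n (n ^ k))) (ℕᵈ.∣m⇒∣m*n _ p∣n))
  where
  to : ∀ k → + p ∣ n ^ suc k → + p ∣ n
  to zero    p∣n^1 = subst (λ z → + p ∣ z) (ℤₚ.*-identityʳ n) p∣n^1
  to (suc k) p∣n^k+2 with euclidsLemma ∣ n ∣ ∣ n ^ suc k ∣ p-prime (subst (p ℕᵈ.∣_) (ℤₚ.abs-* n (n ^ suc k)) p∣n^k+2)
  ... | inj₁ p∣n     = p∣n
  ... | inj₂ p∣n^k+1 = to k p∣n^k+1

3-prime : Prime 3
3-prime = toWitness {a? = prime? 3} _

3∣at1-norm₃⇔3∣at1 : ∀ s → (+ 3 ∣ at1 (norm₃ s)) ⇔ (+ 3 ∣ at1 ⟦ s ⟧)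
3∣at1-norm₃⇔3∣at1 (a , b , c) =
  ⇔-trans (≡⇒⇔∣ (+ 3) (at1-norm₃ a b c))
  (⇔-trans (∣m+d*k⇔∣m (+ 3) (S ^ 3) _)
  (⇔-trans (prime∣^⇔∣ 3-prime S 2)
           (≡⇒⇔∣ (+ 3) (sym (at1-⟦⟧ a b c)))))
  where S = at1 a + at1 b + at1 c

-- Cube roots of unity

module _ {M : Poly} where
  open Congruence (modulo M)

  cubeRoot³≈1 : ∀ {w} → const (+ 1) ⊕ w ⊕ w ⊛ w ≈ [] [mod M ] → w ^ₚ 3 ≈ const (+ 1) [mod M ]
  cubeRoot³≈1 {w} root = ∼-trans
    (≈⇒∼ (solve 1 (λ w → w :^ 3 := con (+ 1) :+ (w :- con (+ 1)) :* (con (+ 1) :+ w :+ w :* w)) ≈-refl w))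
    (∼-trans (+-congˡ (const (+ 1)) (*-congˡ (w ⊟ const (+ 1)) root))
             (≈⇒∼ (⊕-congˡ (const (+ 1)) (⊛-zeroʳ (w ⊟ const (+ 1))) ⟨≈⟩ ⊕-identityʳ (const (+ 1)))))

  cubeRoot^ : ∀ {w} → const (+ 1) ⊕ w ⊕ w ⊛ w ≈ [] [mod M ] →
              ∀ ℓ → ℓ % 3 ≢ 0 → const (+ 1) ⊕ w ^ₚ ℓ ⊕ w ^ₚ ℓ ⊛ w ^ₚ ℓ ≈ [] [mod M ]
  cubeRoot^ {w} root ℓ ℓ≢0 = ∼-trans (+-cong (+-congˡ (const (+ 1)) w^ℓ≈w^r) (*-cong w^ℓ≈w^r w^ℓ≈w^r))
                                     (by-residue (ℓ % 3) (m%n<n ℓ 3) ℓ≢0)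
    where
    w^ℓ≈w^r : w ^ₚ ℓ ≈ w ^ₚ (ℓ % 3) [mod M ]
    w^ℓ≈w^r = ∼-trans (≈⇒∼ (≈-reflexive (cong (w ^ₚ_) (trans (m≡m%n+[m/n]*n ℓ 3) (cong (ℓ % 3 ℕ.+_) (ℕₚ.*-comm (ℓ / 3) 3))))
                          ⟨≈⟩ ^-+ w (ℓ % 3) (3 ℕ.* (ℓ / 3)) ⟨≈⟩ ⊛-congˡ (w ^ₚ (ℓ % 3)) (^-* w 3 (ℓ / 3))))
              (∼-trans (*-congˡ (w ^ₚ (ℓ % 3)) (∼-trans (^-cong (ℓ / 3) (cubeRoot³≈1 {w} root)) (1^n (ℓ / 3))))
                       (≈⇒∼ (⊛-comm (w ^ₚ (ℓ % 3)) (const (+ 1)) ⟨≈⟩ ⊛-identityˡ (w ^ₚ (ℓ % 3)))))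
    by-residue : ∀ r → r ℕ.< 3 → r ≢ 0 → const (+ 1) ⊕ w ^ₚ r ⊕ w ^ₚ r ⊛ w ^ₚ r ≈ [] [mod M ]
    by-residue zero                _   0≢0 = ⊥-elim (0≢0 refl)
    by-residue (suc zero)          _   _   = ∼-trans
      (≈⇒∼ (solve 1 (λ w → con (+ 1) :+ w :^ 1 :+ w :^ 1 :* w :^ 1 := con (+ 1) :+ w :+ w :* w) ≈-refl w)) root
    by-residue (suc (suc zero))    _   _   = ∼-trans
      (≈⇒∼ (solve 1 (λ w → con (+ 1) :+ w :^ 2 :+ w :^ 2 :* w :^ 2
                           := (con (+ 1) :+ w :+ w :* w) :* (con (+ 1) :- w :+ w :* w)) ≈-refl w))
      (*-cong root (∼-refl {const (+ 1) ⊟ w ⊕ w ⊛ w}))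
    by-residue (suc (suc (suc _))) (s≤s (s≤s (s≤s ()))) _

  -- The difference is (1 + w + w²) times the cofactor below: as polynomials in w, its
  -- coefficients w³ − 1, w⁶ − 1, 1 + w + w², 1 + w² + w⁴, 1 + w⁴ + w⁵ are multiples of 1 + w + w².
  conjugates-product : ∀ {w} → const (+ 1) ⊕ w ⊕ w ⊛ w ≈ [] [mod M ] → ∀ z A B C →
    let E = λ y → A ⊕ y ⊛ B ⊕ y ^ₚ 2 ⊛ C in
    E z ⊛ (E (w ⊛ z) ⊛ E (w ⊛ (w ⊛ z))) ≈ normForm (z ^ₚ 3) A B C [mod M ]
  conjugates-product {w} root z A B C = ∼-trans
    (≈⇒∼ (solve 5 (λ w z A B C →
      let E = λ y → A :+ y :* B :+ y :^ 2 :* C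
          a = A
          b = z :* B
          c = z :^ 2 :* C
          cofactor = (a :+ b :+ c) :* ((w :- con (+ 1)) :* b :^ 2 :+ (w :- con (+ 1)) :* (w :^ 3 :+ con (+ 1)) :* c :^ 2
                       :+ a :* b :+ (con (+ 1) :- w :+ w :^ 2) :* a :* c :+ (con (+ 1) :- w :+ w :^ 3) :* b :* c)
      in E z :* (E (w :* z) :* E (w :* (w :* z)))
         := (A :^ 3 :+ z :^ 3 :* B :^ 3 :+ (z :^ 3) :^ 2 :* C :^ 3 :- con (+ 3) :* z :^ 3 :* A :* B :* C)
            :+ (con (+ 1) :+ w :+ w :* w) :* cofactor) ≈-refl w z A B C))
    (∼-trans (+-congˡ (normForm (z ^ₚ 3) A B C) (*-cong root ∼-refl))
             (≈⇒∼ (⊕-identityʳ (normForm (z ^ₚ 3) A B C))))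

∘-resp-mod : ∀ {M N p q} r → M ∘ₚ r ≈ [] [mod N ] → p ≈ q [mod M ] → p ∘ₚ r ≈ q ∘ₚ r [mod N ]
∘-resp-mod {M} {N} {p} {q} r M∘r≈0 (congruent Q p≈q+MQ) = ∼-trans
  (≈⇒∼ (∘-congʳ r p≈q+MQ ⟨≈⟩ ∘-⊕ q (M ⊛ Q) r ⟨≈⟩ ⊕-congˡ (q ∘ₚ r) (∘-⊛ M Q r)))
  (∼-trans (+-congˡ (q ∘ₚ r) (*-cong M∘r≈0 (∼-refl {Q ∘ₚ r})))
           (≈⇒∼ (⊕-identityʳ (q ∘ₚ r))))
  where open Congruence (modulo N)

-- The cyclotomic polynomials Φ3 k

ρ : Poly
ρ = X ⊟ const (+ 1)

ζ : ℕ → Poly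
ζ k = X ^ₚ (3 ℕ.^ k)

1+w+w²-∘ : ∀ w r → (const (+ 1) ⊕ w ⊕ w ⊛ w) ∘ₚ r ≈ const (+ 1) ⊕ w ∘ₚ r ⊕ (w ∘ₚ r) ⊛ (w ∘ₚ r)
1+w+w²-∘ w r = ∘-⊕ (const (+ 1) ⊕ w) (w ⊛ w) r
  ⟨≈⟩ ⊕-cong (∘-⊕ (const (+ 1)) w r ⟨≈⟩ ⊕-congʳ (w ∘ₚ r) (∘-const (+ 1) r)) (∘-⊛ w w r)

Φ3-suc : ∀ k → Φ3 (suc k) ≈ const (+ 1) ⊕ ζ k ⊕ ζ k ⊛ ζ k
Φ3-suc k = ⊕-congˡ (const (+ 1) ⊕ ζ k)
  (^-+ X (3 ℕ.^ k) (3 ℕ.^ k ℕ.+ 0) ⟨≈⟩ ⊛-congˡ (ζ k) (≈-reflexive (cong (X ^ₚ_) (ℕₚ.+-identityʳ (3 ℕ.^ k)))))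

ζ-root : ∀ k → const (+ 1) ⊕ ζ k ⊕ ζ k ⊛ ζ k ≈ [] [mod Φ3 (suc k) ]
ζ-root k = mod-trans (≈⇒≈mod (≈-sym (Φ3-suc k))) modulus≈0

ζ-∘ : ∀ k t → ζ k ∘ₚ ζ t ≈ ζ (k ℕ.+ t)
ζ-∘ k t = X^-∘-X^ (3 ℕ.^ k) (3 ℕ.^ t)
  ⟨≈⟩ ≈-reflexive (cong (X ^ₚ_) (trans (ℕₚ.*-comm (3 ℕ.^ t) (3 ℕ.^ k)) (sym (ℕₚ.^-distribˡ-+-* 3 k t))))

Φ3-∘-ζ : ∀ k t → Φ3 (suc k) ∘ₚ ζ t ≈ Φ3 (suc (k ℕ.+ t))
Φ3-∘-ζ k t = ∘-congʳ (ζ t) (Φ3-suc k) ⟨≈⟩ 1+w+w²-∘ (ζ k) (ζ t)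
  ⟨≈⟩ ⊕-cong (⊕-congˡ (const (+ 1)) (ζ-∘ k t)) (⊛-cong (ζ-∘ k t) (ζ-∘ k t)) ⟨≈⟩ ≈-sym (Φ3-suc (k ℕ.+ t))

Φ3-suc≈∘X³ : ∀ k → Φ3 (suc (suc k)) ≈ Φ3 (suc k) ∘ₚ X³
Φ3-suc≈∘X³ k = ≈-reflexive (cong (λ n → Φ3 (suc n)) (ℕₚ.+-comm 1 k)) ⟨≈⟩ ≈-sym (Φ3-∘-ζ k 1)

Φ3-∘-unit : ∀ k ℓ → ℓ % 3 ≢ 0 → Φ3 (suc k) ∘ₚ (X ^ₚ ℓ) ≈ [] [mod Φ3 (suc k) ]
Φ3-∘-unit k ℓ ℓ≢0 = mod-trans (≈⇒≈mod Φ3∘X^ℓ) (cubeRoot^ (ζ-root k) ℓ ℓ≢0)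
  where
  ζ∘X^ℓ : ζ k ∘ₚ (X ^ₚ ℓ) ≈ ζ k ^ₚ ℓ
  ζ∘X^ℓ = X^-∘-X^ (3 ℕ.^ k) ℓ ⟨≈⟩ ≈-reflexive (cong (X ^ₚ_) (ℕₚ.*-comm ℓ (3 ℕ.^ k))) ⟨≈⟩ ^-* X (3 ℕ.^ k) ℓ
  Φ3∘X^ℓ : Φ3 (suc k) ∘ₚ (X ^ₚ ℓ) ≈ const (+ 1) ⊕ ζ k ^ₚ ℓ ⊕ ζ k ^ₚ ℓ ⊛ ζ k ^ₚ ℓ
  Φ3∘X^ℓ = ∘-congʳ (X ^ₚ ℓ) (Φ3-suc k) ⟨≈⟩ 1+w+w²-∘ (ζ k) (X ^ₚ ℓ)
    ⟨≈⟩ ⊕-cong (⊕-congˡ (const (+ 1)) ζ∘X^ℓ) (⊛-cong ζ∘X^ℓ ζ∘X^ℓ)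

1+X+⋯+X^ : ℕ → Poly
1+X+⋯+X^ zero    = []
1+X+⋯+X^ (suc n) = const (+ 1) ⊕ X ⊛ 1+X+⋯+X^ n

ρ-∘-X^ : ∀ n → ρ ∘ₚ (X ^ₚ n) ≈ ρ ⊛ 1+X+⋯+X^ n
ρ-∘-X^ n = ρ∘ (X ^ₚ n) ⟨≈⟩ geometric n
  where
  ρ∘ : ∀ r → ρ ∘ₚ r ≈ r ⊟ const (+ 1)
  ρ∘ r = ∘-⊕ X (neg (const (+ 1))) r ⟨≈⟩ ⊕-cong (∘-X r) (∘-· (- + 1) (const (+ 1)) r ⟨≈⟩ ·-congˡ (- + 1) (∘-const (+ 1) r))
  geometric : ∀ n → X ^ₚ n ⊟ const (+ 1) ≈ ρ ⊛ 1+X+⋯+X^ n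
  geometric zero    = ⊕-inverseʳ (const (+ 1)) ⟨≈⟩ ≈-sym (⊛-zeroʳ ρ)
  geometric (suc n) =
    solve 2 (λ x y → x :* y :- con (+ 1) := x :* (y :- con (+ 1)) :+ (x :- con (+ 1))) ≈-refl X (X ^ₚ n)
    ⟨≈⟩ ⊕-congʳ ρ (⊛-congˡ X (geometric n))
    ⟨≈⟩ solve 2 (λ x s → x :* ((x :- con (+ 1)) :* s) :+ (x :- con (+ 1)) := (x :- con (+ 1)) :* (con (+ 1) :+ x :* s))
          ≈-refl X (1+X+⋯+X^ n)

-- At level 2, 3 = ∏ (1 − ζ₉ˡ) over the six units ℓ is ρ⁶ times a unit of ℤ[ζ₉];
-- V₂ and C₂ certify this in ℤ[X].
3≈ρ⁶V : ∀ t → ∃ λ V → const (+ 3) ≈ ρ ^ₚ 6 ⊛ V [mod Φ3 (suc (suc t)) ]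
3≈ρ⁶V t = S ^ₚ 6 ⊛ (V₂ ∘ₚ ζ t) , congruent (C₂ ∘ₚ ζ t) (
  ≈-sym (∘-const (+ 3) (ζ t)) ⟨≈⟩ ∘-congʳ (ζ t) (≈-sym certificate)
  ⟨≈⟩ ∘-⊕ (ρ ^ₚ 6 ⊛ V₂) (Φ3 2 ⊛ C₂) (ζ t)
  ⟨≈⟩ ⊕-cong (∘-⊛ (ρ ^ₚ 6) V₂ (ζ t) ⟨≈⟩ ⊛-congʳ (V₂ ∘ₚ ζ t) (∘-^ ρ 6 (ζ t) ⟨≈⟩ ℤ[X].^-cong 6 (ρ-∘-X^ (3 ℕ.^ t))))
             (∘-⊛ (Φ3 2) C₂ (ζ t) ⟨≈⟩ ⊛-congʳ (C₂ ∘ₚ ζ t) (Φ3-∘-ζ 1 t))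
  ⟨≈⟩ ⊕-congʳ (Φ3 (suc (suc t)) ⊛ (C₂ ∘ₚ ζ t))
        (solve 3 (λ r s v → (r :* s) :^ 6 :* v := r :^ 6 :* (s :^ 6 :* v)) ≈-refl ρ S (V₂ ∘ₚ ζ t)))
  where
  S = 1+X+⋯+X^ (3 ℕ.^ t)
  V₂ C₂ : Poly
  V₂ = + 10 ∷ + 11 ∷ + 7 ∷ + 10 ∷ + 4 ∷ - + 4 ∷ []
  C₂ = - + 7 ∷ + 49 ∷ - + 91 ∷ + 74 ∷ - + 28 ∷ + 4 ∷ []
  certificate : ρ ^ₚ 6 ⊛ V₂ ⊕ Φ3 2 ⊛ C₂ ≈ const (+ 3)
  certificate = from-yes (ρ ^ₚ 6 ⊛ V₂ ⊕ Φ3 2 ⊛ C₂ ≈? const (+ 3))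

-- Units modulo 3^k

applyUpTo-+ : ∀ {A : Set} (f : ℕ → A) m n → applyUpTo f (m ℕ.+ n) ≡ applyUpTo f m ++ applyUpTo (f ∘ (m ℕ.+_)) n
applyUpTo-+ f zero    n = refl
applyUpTo-+ f (suc m) n = cong (f 0 ∷_) (applyUpTo-+ (f ∘ suc) m n)

map-suc-upTo-+ : ∀ m n → map suc (upTo (m ℕ.+ n)) ≡ map suc (upTo m) ++ map (m ℕ.+_) (map suc (upTo n))
map-suc-upTo-+ m n = begin
  map suc (upTo (m ℕ.+ n))                             ≡⟨ cong (map suc) (applyUpTo-+ id m n) ⟩
  map suc (upTo m ++ applyUpTo (m ℕ.+_) n)             ≡⟨ map-++ suc (upTo m) _ ⟩
  map suc (upTo m) ++ map suc (applyUpTo (m ℕ.+_) n)   ≡⟨ cong (λ xs → map suc (upTo m) ++ map suc xs) (sym (map-upTo (m ℕ.+_) n)) ⟩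
  map suc (upTo m) ++ map suc (map (m ℕ.+_) (upTo n))  ≡⟨ cong (map suc (upTo m) ++_) shift-swap ⟩
  map suc (upTo m) ++ map (m ℕ.+_) (map suc (upTo n))  ∎
  where
  open ≡-Reasoning
  shift-swap : map suc (map (m ℕ.+_) (upTo n)) ≡ map (m ℕ.+_) (map suc (upTo n))
  shift-swap = trans (sym (map-∘ (upTo n))) (trans (map-cong (λ i → sym (ℕₚ.+-suc m i)) (upTo n)) (map-∘ (upTo n)))

filterᵇ-map : ∀ (p : ℕ → Bool) f → (∀ x → p (f x) ≡ p x) → ∀ xs → filterᵇ p (map f xs) ≡ map f (filterᵇ p xs)
filterᵇ-map p f p∘f≗p []       = refl
filterᵇ-map p f p∘f≗p (x ∷ xs) rewrite p∘f≗p x with p x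
... | true  = cong (f x ∷_) (filterᵇ-map p f p∘f≗p xs)
... | false = filterᵇ-map p f p∘f≗p xs

isUnit : ℕ → Bool
isUnit ℓ = not (ℓ % 3 ≡ᵇ 0)

isUnit-shift : ∀ n ℓ → isUnit (3 ℕ.* n ℕ.+ ℓ) ≡ isUnit ℓ
isUnit-shift n ℓ = cong (λ r → not (r ≡ᵇ 0))
  (trans (cong (_% 3) (trans (ℕₚ.+-comm (3 ℕ.* n) ℓ) (cong (ℓ ℕ.+_) (ℕₚ.*-comm 3 n)))) ([m+kn]%n≡m%n ℓ n 3))

units-split : ∀ k → let U = units (suc k) ; N = 3 ℕ.^ suc k in
  units (suc (suc k)) ≡ U ++ map (N ℕ.+_) U ++ map ((N ℕ.+ N) ℕ.+_) U
units-split k = begin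
  filterᵇ isUnit (map suc (upTo (N ℕ.+ (N ℕ.+ (N ℕ.+ 0)))))
    ≡⟨ cong (filterᵇ isUnit) range ⟩
  filterᵇ isUnit (R ++ map (N ℕ.+_) R ++ map ((N ℕ.+ N) ℕ.+_) R)
    ≡⟨ filter-++ (T? ∘ isUnit) R _ ⟩
  U ++ filterᵇ isUnit (map (N ℕ.+_) R ++ map ((N ℕ.+ N) ℕ.+_) R)
    ≡⟨ cong (U ++_) (filter-++ (T? ∘ isUnit) (map (N ℕ.+_) R) _) ⟩
  U ++ filterᵇ isUnit (map (N ℕ.+_) R) ++ filterᵇ isUnit (map ((N ℕ.+ N) ℕ.+_) R)
    ≡⟨ cong₂ (λ xs ys → U ++ xs ++ ys) (filterᵇ-map isUnit (N ℕ.+_) (isUnit-shift (3 ℕ.^ k)) R)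
                                       (filterᵇ-map isUnit ((N ℕ.+ N) ℕ.+_) shift₂ R) ⟩
  U ++ map (N ℕ.+_) U ++ map ((N ℕ.+ N) ℕ.+_) U
    ∎
  where
  open ≡-Reasoning
  N = 3 ℕ.^ suc k
  R = map suc (upTo N)
  U = filterᵇ isUnit R
  shift₂ : ∀ ℓ → isUnit ((N ℕ.+ N) ℕ.+ ℓ) ≡ isUnit ℓ
  shift₂ ℓ = trans (cong isUnit (ℕₚ.+-assoc N N ℓ)) (trans (isUnit-shift (3 ℕ.^ k) (N ℕ.+ ℓ)) (isUnit-shift (3 ℕ.^ k) ℓ))
  range : map suc (upTo (N ℕ.+ (N ℕ.+ (N ℕ.+ 0)))) ≡ R ++ map (N ℕ.+_) R ++ map ((N ℕ.+ N) ℕ.+_) R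
  range = begin
    map suc (upTo (N ℕ.+ (N ℕ.+ (N ℕ.+ 0))))
      ≡⟨ map-suc-upTo-+ N (N ℕ.+ (N ℕ.+ 0)) ⟩
    R ++ map (N ℕ.+_) (map suc (upTo (N ℕ.+ (N ℕ.+ 0))))
      ≡⟨ cong (λ xs → R ++ map (N ℕ.+_) xs)
              (trans (map-suc-upTo-+ N (N ℕ.+ 0)) (cong (λ n → R ++ map (N ℕ.+_) (map suc (upTo n))) (ℕₚ.+-identityʳ N))) ⟩
    R ++ map (N ℕ.+_) (R ++ map (N ℕ.+_) R)
      ≡⟨ cong (R ++_) (trans (map-++ (N ℕ.+_) R _)
              (cong (map (N ℕ.+_) R ++_) (trans (sym (map-∘ R)) (map-cong (λ ℓ → sym (ℕₚ.+-assoc N N ℓ)) R)))) ⟩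
    R ++ map (N ℕ.+_) R ++ map ((N ℕ.+ N) ℕ.+_) R
      ∎

units-nonzero : ∀ k → All (λ ℓ → ℓ % 3 ≢ 0) (units k)
units-nonzero k = All.map (λ {ℓ} isUnit-ℓ ℓ%3≡0 → subst (λ r → Data.Bool.T (not (r ≡ᵇ 0))) ℓ%3≡0 isUnit-ℓ)
                          (all-filter (T? ∘ isUnit) (map suc (upTo (3 ℕ.^ k))))

prodP-++ : ∀ xs ys → prodP (xs ++ ys) ≈ prodP xs ⊛ prodP ys
prodP-++ []       ys = ≈-sym (⊛-identityˡ (prodP ys))
prodP-++ (x ∷ xs) ys = ⊛-congˡ x (prodP-++ xs ys) ⟨≈⟩ ≈-sym (⊛-assoc x (prodP xs) (prodP ys))

prodP-map-⊛ : ∀ {A : Set} (f g : A → Poly) xs → prodP (map (λ x → f x ⊛ g x) xs) ≈ prodP (map f xs) ⊛ prodP (map g xs)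
prodP-map-⊛ f g []       = ≈-sym (⊛-identityˡ (const (+ 1)))
prodP-map-⊛ f g (x ∷ xs) = ⊛-congˡ (f x ⊛ g x) (prodP-map-⊛ f g xs) ⟨≈⟩
  solve 4 (λ a b A B → (a :* b) :* (A :* B) := (a :* A) :* (b :* B)) ≈-refl (f x) (g x) (prodP (map f xs)) (prodP (map g xs))

prodP-map-∘ : ∀ {A : Set} (f : A → Poly) xs r → prodP (map f xs) ∘ₚ r ≈ prodP (map (λ x → f x ∘ₚ r) xs)
prodP-map-∘ f []       r = ∘-const (+ 1) r
prodP-map-∘ f (x ∷ xs) r = ∘-⊛ (f x) (prodP (map f xs)) r ⟨≈⟩ ⊛-congˡ (f x ∘ₚ r) (prodP-map-∘ f xs r)

normPoly-⊛ : ∀ k G H → normPoly k (G ⊛ H) ≈ normPoly k G ⊛ normPoly k H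
normPoly-⊛ k G H =
  ℤ[X].prodP-map-cong (units k) (All.tabulate (λ {ℓ} _ → ∘-⊛ G H (X ^ₚ ℓ)))
  ⟨≈⟩ prodP-map-⊛ (λ ℓ → G ∘ₚ (X ^ₚ ℓ)) (λ ℓ → H ∘ₚ (X ^ₚ ℓ)) (units k)

normPoly-resp-mod : ∀ k {G G′} → G ≈ G′ [mod Φ3 (suc k) ] → normPoly (suc k) G ≈ normPoly (suc k) G′ [mod Φ3 (suc k) ]
normPoly-resp-mod k G≈G′ =
  Congruence.prodP-map-cong (modulo (Φ3 (suc k))) (units (suc k))
    (All.map (λ {ℓ} ℓ≢0 → ∘-resp-mod (X ^ₚ ℓ) (Φ3-∘-unit k ℓ ℓ≢0) G≈G′) (units-nonzero (suc k)))

NormEq⇒≈mod : ∀ {k G m} → NormEq k G m → normPoly k G ≈ const m [mod Φ3 k ]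
NormEq⇒≈mod (Q , e) = congruent Q (coeffwise e)

≈mod⇒NormEq : ∀ {k G m} → normPoly k G ≈ const m [mod Φ3 k ] → NormEq k G m
≈mod⇒NormEq (congruent Q e) = Q , coeff-≡ e

NormEq-resp-≈ : ∀ {k G G′ m} → G ≈ G′ → NormEq k G m → NormEq k G′ m
NormEq-resp-≈ {k} {G} {G′} G≈G′ normEq = ≈mod⇒NormEq {k} {G′}
  (mod-trans (≈⇒≈mod (ℤ[X].prodP-map-cong (units k) (All.tabulate (λ {ℓ} _ → ∘-congʳ (X ^ₚ ℓ) (≈-sym G≈G′)))))
             (NormEq⇒≈mod {k} {G} normEq))

∘X³-reflects-≈mod : ∀ {M P m} → P ∘ₚ X³ ≈ const m [mod M ∘ₚ X³ ] → P ≈ const m [mod M ]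
∘X³-reflects-≈mod {M} {P} {m} (congruent Q e) = congruent Q₀
  (⟦⟧-injective₀ (ι₃ P) (ι₃ (const m) ⊕₃ ι₃ M ⊛₃ split Q) lift
   ⟨≈⟩ ⊕-congˡ (const m) (⊕-congˡ (M ⊛ Q₀) (⊛-zeroʳ X) ⟨≈⟩ ⊕-identityʳ (M ⊛ Q₀)))
  where
  Q₀ = proj₁ (split Q)
  lift : ⟦ ι₃ P ⟧ ≈ ⟦ ι₃ (const m) ⊕₃ ι₃ M ⊛₃ split Q ⟧
  lift = ⟦ι₃⟧ P ⟨≈⟩ e ⟨≈⟩ ⊕-cong (≈-sym (⟦ι₃⟧ (const m) ⟨≈⟩ ∘-const m X³))
                                 (⊛-cong (≈-sym (⟦ι₃⟧ M)) (≈-sym (⟦split⟧ Q)) ⟨≈⟩ ≈-sym (⟦⟧-⊛₃ (ι₃ M) (split Q)))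
         ⟨≈⟩ ≈-sym (⟦⟧-⊕₃ (ι₃ (const m)) (ι₃ M ⊛₃ split Q))

module _ (k : ℕ) {G : Poly} (s : Split) (G≈⟦s⟧ : G ≈ ⟦ s ⟧) where
  private
    N = 3 ℕ.^ suc k
    w = ζ (suc k)
    f : ℕ → Poly
    f j = G ∘ₚ (X ^ₚ j)
    open Congruence (modulo (Φ3 (suc (suc k))))

    w-invariant : ∀ y → (w ⊛ y) ^ₚ 3 ∼ y ^ₚ 3
    w-invariant y = ∼-trans (≈⇒∼ (^-distrib-⊛ w y 3))
      (∼-trans (*-cong (cubeRoot³≈1 {w = w} (ζ-root (suc k))) (∼-refl {y ^ₚ 3})) (≈⇒∼ (⊛-identityˡ (y ^ₚ 3))))

  -- With z = X^ℓ, the three factors are G(z), G(ζ z), G(ζ² z) for the cube root of unity ζ = X^N.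
  conjugate-triple : ∀ ℓ → f ℓ ⊛ (f (N ℕ.+ ℓ) ⊛ f ((N ℕ.+ N) ℕ.+ ℓ)) ≈ (norm₃ s ∘ₚ (X ^ₚ ℓ)) ∘ₚ X³ [mod Φ3 (suc (suc k)) ]
  conjugate-triple ℓ = ∼-trans
    (*-cong (f≈E ℓ z ≈-refl ∼-refl)
      (*-cong (f≈E (N ℕ.+ ℓ) (w ⊛ z) (X^N+j≈w⊛X^j ℓ) (w-invariant z))
              (f≈E ((N ℕ.+ N) ℕ.+ ℓ) (w ⊛ (w ⊛ z))
                   (≈-reflexive (cong (X ^ₚ_) (ℕₚ.+-assoc N N ℓ)) ⟨≈⟩ X^N+j≈w⊛X^j (N ℕ.+ ℓ) ⟨≈⟩ ⊛-congˡ w (X^N+j≈w⊛X^j ℓ))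
                   (∼-trans (w-invariant (w ⊛ z)) (w-invariant z)))))
    (∼-trans (conjugates-product {w = w} (ζ-root (suc k)) z (a ∘ₚ t) (b ∘ₚ t) (c ∘ₚ t))
             (≈⇒∼ (≈-sym norm-at-z³)))
    where
    a = proj₁ s
    b = proj₁ (proj₂ s)
    c = proj₂ (proj₂ s)
    z = X ^ₚ ℓ
    t = z ^ₚ 3
    E : Poly → Poly
    E y = a ∘ₚ t ⊕ y ⊛ (b ∘ₚ t) ⊕ y ^ₚ 2 ⊛ (c ∘ₚ t)
    f≈E : ∀ j y → X ^ₚ j ≈ y → y ^ₚ 3 ∼ t → f j ∼ E y
    f≈E j y X^j≈y y³∼t = ∼-trans
      (≈⇒∼ (∘-congʳ (X ^ₚ j) G≈⟦s⟧ ⟨≈⟩ ℤ[X].∘-congˡ ⟦ s ⟧ X^j≈y ⟨≈⟩ ⟦⟧-∘ a b c y))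
      (+-cong (+-cong (∘-congˡ a y³∼t) (*-congˡ y (∘-congˡ b y³∼t))) (*-congˡ (y ^ₚ 2) (∘-congˡ c y³∼t)))
    X^N+j≈w⊛X^j : ∀ j → X ^ₚ (N ℕ.+ j) ≈ w ⊛ X ^ₚ j
    X^N+j≈w⊛X^j j = ^-+ X N j
    z∘X³≈t : z ∘ₚ X³ ≈ t
    z∘X³≈t = X^-∘-X^ ℓ 3 ⟨≈⟩ ≈-reflexive (cong (X ^ₚ_) (ℕₚ.*-comm 3 ℓ)) ⟨≈⟩ ^-* X ℓ 3
    norm-at-z³ : (norm₃ s ∘ₚ z) ∘ₚ X³ ≈ normForm t (a ∘ₚ t) (b ∘ₚ t) (c ∘ₚ t)
    norm-at-z³ = ∘-assoc (norm₃ s) z X³ ⟨≈⟩ ℤ[X].∘-congˡ (norm₃ s) z∘X³≈t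
                 ⟨≈⟩ normForm-∘ X a b c t ⟨≈⟩ normForm-congˡ (a ∘ₚ t) (b ∘ₚ t) (c ∘ₚ t) (∘-X t)

  normPoly-by-triples : normPoly (suc (suc k)) G ≈ prodP (map (λ ℓ → f ℓ ⊛ (f (N ℕ.+ ℓ) ⊛ f ((N ℕ.+ N) ℕ.+ ℓ))) (units (suc k)))
  normPoly-by-triples =
    ≈-reflexive (cong (λ L → prodP (map f L)) (units-split k))
    ⟨≈⟩ ≈-reflexive (cong prodP (trans (map-++ f U _) (cong (map f U ++_) (map-++ f (map (N ℕ.+_) U) _))))
    ⟨≈⟩ prodP-++ (map f U) _ ⟨≈⟩ ⊛-congˡ (prodP (map f U)) (prodP-++ (map f (map (N ℕ.+_) U)) _)
    ⟨≈⟩ ⊛-congˡ (prodP (map f U)) (⊛-cong (≈-reflexive (cong prodP (sym (map-∘ U)))) (≈-reflexive (cong prodP (sym (map-∘ U)))))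
    ⟨≈⟩ ⊛-congˡ (prodP (map f U)) (≈-sym (prodP-map-⊛ (f ∘ (N ℕ.+_)) (f ∘ ((N ℕ.+ N) ℕ.+_)) U))
    ⟨≈⟩ ≈-sym (prodP-map-⊛ f (λ ℓ → f (N ℕ.+ ℓ) ⊛ f ((N ℕ.+ N) ℕ.+ ℓ)) U)
    where U = units (suc k)

  relativeNorm : ∀ {m} → NormEq (suc (suc k)) G m → NormEq (suc k) (norm₃ s) m
  relativeNorm {m} normEq = ≈mod⇒NormEq {suc k} {norm₃ s} (∘X³-reflects-≈mod (mod-cong-modulus (Φ3-suc≈∘X³ k) lifted))
    where
    lifted : normPoly (suc k) (norm₃ s) ∘ₚ X³ ≈ const m [mod Φ3 (suc (suc k)) ]
    lifted = ∼-trans (≈⇒∼ (prodP-map-∘ (λ ℓ → norm₃ s ∘ₚ (X ^ₚ ℓ)) (units (suc k)) X³))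
             (∼-trans (∼-sym (prodP-map-cong (units (suc k)) (All.tabulate (λ {ℓ} _ → conjugate-triple ℓ))))
             (∼-trans (≈⇒∼ (≈-sym normPoly-by-triples)) (NormEq⇒≈mod {suc (suc k)} {G} normEq)))

-- The ideal ⟨3, g⟩

infix 4 _∈⟨3,_⟩
record _∈⟨3,_⟩ (p g : Poly) : Set where
  constructor combination
  field
    u v     : Poly
    ≈-comb : p ≈ const (+ 3) ⊛ u ⊕ g ⊛ v
open _∈⟨3,_⟩ public

module _ {g : Poly} where

  ∈-cong : ∀ {p q} → p ≈ q → p ∈⟨3, g ⟩ → q ∈⟨3, g ⟩
  ∈-cong p≈q (combination u v e) = combination u v (≈-sym p≈q ⟨≈⟩ e)

  ∈-⊕ : ∀ {p q} → p ∈⟨3, g ⟩ → q ∈⟨3, g ⟩ → p ⊕ q ∈⟨3, g ⟩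
  ∈-⊕ (combination u v e) (combination u′ v′ e′) = combination (u ⊕ u′) (v ⊕ v′) (⊕-cong e e′ ⟨≈⟩
    solve 5 (λ g u v u′ v′ → (con (+ 3) :* u :+ g :* v) :+ (con (+ 3) :* u′ :+ g :* v′)
                           := con (+ 3) :* (u :+ u′) :+ g :* (v :+ v′)) ≈-refl g u v u′ v′)

  ∈-⊛ʳ : ∀ {p} → p ∈⟨3, g ⟩ → ∀ r → p ⊛ r ∈⟨3, g ⟩
  ∈-⊛ʳ (combination u v e) r = combination (u ⊛ r) (v ⊛ r) (⊛-congʳ r e ⟨≈⟩
    solve 4 (λ g u v r → (con (+ 3) :* u :+ g :* v) :* r := con (+ 3) :* (u :* r) :+ g :* (v :* r)) ≈-refl g u v r)

  ∈-⊛ˡ : ∀ r {p} → p ∈⟨3, g ⟩ → r ⊛ p ∈⟨3, g ⟩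
  ∈-⊛ˡ r {p} p∈ = ∈-cong (⊛-comm p r) (∈-⊛ʳ p∈ r)

  ∈-neg : ∀ {p} → p ∈⟨3, g ⟩ → neg p ∈⟨3, g ⟩
  ∈-neg {p} p∈ = ∈-cong (⊛-const p (- + 1)) (∈-⊛ʳ p∈ (const (- + 1)))

  3⊛∈ : ∀ p → const (+ 3) ⊛ p ∈⟨3, g ⟩
  3⊛∈ p = combination p [] (≈-sym (⊕-congˡ (const (+ 3) ⊛ p) (⊛-zeroʳ g) ⟨≈⟩ ⊕-identityʳ (const (+ 3) ⊛ p)))

  g⊛∈ : ∀ p → g ⊛ p ∈⟨3, g ⟩
  g⊛∈ p = combination [] p (≈-sym (⊕-congʳ (g ⊛ p) (⊛-zeroʳ (const (+ 3)))))

  at1-∈ : ∀ {p} (p∈ : p ∈⟨3, g ⟩) → at1 g ≡ + 0 → at1 p ≡ + 3 * at1 (u p∈)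
  at1-∈ {p} (combination u v e) g₁≡0 = begin
    at1 p                                ≡⟨ at1-cong e ⟩
    at1 (const (+ 3) ⊛ u ⊕ g ⊛ v)        ≡⟨ at1-⊕ (const (+ 3) ⊛ u) (g ⊛ v) ⟩
    at1 (const (+ 3) ⊛ u) + at1 (g ⊛ v)  ≡⟨ cong₂ _+_ (at1-⊛ (const (+ 3)) u) (at1-⊛ g v) ⟩
    + 3 * at1 u + at1 g * at1 v          ≡⟨ cong (λ x → + 3 * at1 u + x * at1 v) g₁≡0 ⟩
    + 3 * at1 u + + 0 * at1 v            ≡⟨ ℤₚ.+-identityʳ (+ 3 * at1 u) ⟩
    + 3 * at1 u                          ∎
    where open ≡-Reasoning

traceTerm-∈ : ∀ {g} s → proj₁ s ∈⟨3, g ⟩ → proj₂ (proj₂ s) ∈⟨3, g ⟩ → traceTerm s ∈⟨3, g ⟩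
traceTerm-∈ (a , b , c) a∈ c∈ = ∈-⊕ (∈-⊕ a∈ (∈-⊛ʳ a∈ a)) (∈-neg (∈-⊛ˡ (X ⊛ b) c∈))

infix 4 _≈₃_
_≈₃_ : Split → Split → Set
(a , b , c) ≈₃ (a′ , b′ , c′) = a ≈ a′ × b ≈ b′ × c ≈ c′

infix 4 _≈₃?_
_≈₃?_ : ∀ s t → Dec (s ≈₃ t)
(a , b , c) ≈₃? (a′ , b′ , c′) = (a ≈? a′) ×-dec ((b ≈? b′) ×-dec (c ≈? c′))

infixl 7 _·₃_
_·₃_ : Poly → Split → Split
p ·₃ (a , b , c) = p ⊛ a , p ⊛ b , p ⊛ c

⊛₃-mod3 : ∀ g U V T H → T ≈₃ g ·₃ U ⊕₃ const (+ 3) ·₃ V →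
          T ⊛₃ H ≈₃ g ·₃ (U ⊛₃ H) ⊕₃ const (+ 3) ·₃ (V ⊛₃ H)
⊛₃-mod3 g (U₀ , U₁ , U₂) (V₀ , V₁ , V₂) (T₀ , T₁ , T₂) (H₀ , H₁ , H₂) (e₀ , e₁ , e₂) =
  ( (⊕-cong (⊛-congʳ H₀ e₀) (⊛-congˡ X (⊕-cong (⊛-congʳ H₂ e₁) (⊛-congʳ H₁ e₂)))
    ⟨≈⟩ solve 11 (λ x g u₀ u₁ u₂ v₀ v₁ v₂ h₀ h₁ h₂ →
          let t₀ = g :* u₀ :+ con (+ 3) :* v₀ ; t₁ = g :* u₁ :+ con (+ 3) :* v₁ ; t₂ = g :* u₂ :+ con (+ 3) :* v₂ in
          t₀ :* h₀ :+ x :* (t₁ :* h₂ :+ t₂ :* h₁)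
          := g :* (u₀ :* h₀ :+ x :* (u₁ :* h₂ :+ u₂ :* h₁)) :+ con (+ 3) :* (v₀ :* h₀ :+ x :* (v₁ :* h₂ :+ v₂ :* h₁)))
          ≈-refl X g U₀ U₁ U₂ V₀ V₁ V₂ H₀ H₁ H₂)
  , (⊕-cong (⊕-cong (⊛-congʳ H₁ e₀) (⊛-congʳ H₀ e₁)) (⊛-congˡ X (⊛-congʳ H₂ e₂))
    ⟨≈⟩ solve 11 (λ x g u₀ u₁ u₂ v₀ v₁ v₂ h₀ h₁ h₂ →
          let t₀ = g :* u₀ :+ con (+ 3) :* v₀ ; t₁ = g :* u₁ :+ con (+ 3) :* v₁ ; t₂ = g :* u₂ :+ con (+ 3) :* v₂ in
          t₀ :* h₁ :+ t₁ :* h₀ :+ x :* (t₂ :* h₂)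
          := g :* (u₀ :* h₁ :+ u₁ :* h₀ :+ x :* (u₂ :* h₂)) :+ con (+ 3) :* (v₀ :* h₁ :+ v₁ :* h₀ :+ x :* (v₂ :* h₂)))
          ≈-refl X g U₀ U₁ U₂ V₀ V₁ V₂ H₀ H₁ H₂)
  , (⊕-cong (⊕-cong (⊛-congʳ H₂ e₀) (⊛-congʳ H₁ e₁)) (⊛-congʳ H₀ e₂)
    ⟨≈⟩ solve 10 (λ g u₀ u₁ u₂ v₀ v₁ v₂ h₀ h₁ h₂ →
          let t₀ = g :* u₀ :+ con (+ 3) :* v₀ ; t₁ = g :* u₁ :+ con (+ 3) :* v₁ ; t₂ = g :* u₂ :+ con (+ 3) :* v₂ in
          t₀ :* h₂ :+ t₁ :* h₁ :+ t₂ :* h₀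
          := g :* (u₀ :* h₂ :+ u₁ :* h₁ :+ u₂ :* h₀) :+ con (+ 3) :* (v₀ :* h₂ :+ v₁ :* h₁ :+ v₂ :* h₀))
          ≈-refl g U₀ U₁ U₂ V₀ V₁ V₂ H₀ H₁ H₂) )

mod3⇒∈ : ∀ {p g} x y → p ≈ g ⊛ x ⊕ const (+ 3) ⊛ y → p ∈⟨3, g ⟩
mod3⇒∈ {g = g} x y e = combination y x (e ⟨≈⟩ ⊕-comm (g ⊛ x) (const (+ 3) ⊛ y))

⊛₃-∈ : ∀ g U V T H → T ≈₃ g ·₃ U ⊕₃ const (+ 3) ·₃ V →
       proj₁ (T ⊛₃ H) ∈⟨3, g ⟩ × proj₁ (proj₂ (T ⊛₃ H)) ∈⟨3, g ⟩ × proj₂ (proj₂ (T ⊛₃ H)) ∈⟨3, g ⟩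
⊛₃-∈ g U V T H T≈ =
    mod3⇒∈ (proj₁ (U ⊛₃ H)) (proj₁ (V ⊛₃ H)) (proj₁ e)
  , mod3⇒∈ (proj₁ (proj₂ (U ⊛₃ H))) (proj₁ (proj₂ (V ⊛₃ H))) (proj₁ (proj₂ e))
  , mod3⇒∈ (proj₂ (proj₂ (U ⊛₃ H))) (proj₂ (proj₂ (V ⊛₃ H))) (proj₂ (proj₂ e))
  where e = ⊛₃-mod3 g U V T H T≈

traceTerm-⊛₃-∈ : ∀ g U V T → T ≈₃ g ·₃ U ⊕₃ const (+ 3) ·₃ V → ∀ H → traceTerm (T ⊛₃ H) ∈⟨3, g ⟩
traceTerm-⊛₃-∈ g U V T T≈ H = traceTerm-∈ (T ⊛₃ H) (proj₁ m) (proj₂ (proj₂ m))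
  where m = ⊛₃-∈ g U V T H T≈

-- Lowering the level

1+ρ^ : ℕ → Poly → Poly
1+ρ^ e h = const (+ 1) ⊕ ρ ^ₚ e ⊛ h

module Lowering (e : ℕ) (norm₃[ρ^e] : norm₃ (split (ρ ^ₚ e)) ≈ ρ ^ₚ e) where

  T : Split
  T = split (ρ ^ₚ e)

  trace : Poly → Poly
  trace h = traceTerm (T ⊛₃ split h)

  relativeNorm-1+ρ^ : ∀ k h {m} → NormEq (suc (suc k)) (1+ρ^ e h) m →
            NormEq (suc k) (const (+ 1) ⊕ const (+ 3) ⊛ trace h ⊕ ρ ^ₚ e ⊛ norm₃ (split h)) m
  relativeNorm-1+ρ^ k h normEq = NormEq-resp-≈ {suc k} {norm₃ S} expansion (relativeNorm k S splitting normEq)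
    where
    S = ι₃ (const (+ 1)) ⊕₃ T ⊛₃ split h
    splitting : 1+ρ^ e h ≈ ⟦ S ⟧
    splitting =
      ⊕-cong (≈-sym (⟦ι₃⟧ (const (+ 1)) ⟨≈⟩ ∘-const (+ 1) X³))
             (⊛-cong (≈-sym (⟦split⟧ (ρ ^ₚ e))) (≈-sym (⟦split⟧ h)) ⟨≈⟩ ≈-sym (⟦⟧-⊛₃ T (split h)))
      ⟨≈⟩ ≈-sym (⟦⟧-⊕₃ (ι₃ (const (+ 1))) (T ⊛₃ split h))
    expansion : norm₃ S ≈ const (+ 1) ⊕ const (+ 3) ⊛ trace h ⊕ ρ ^ₚ e ⊛ norm₃ (split h)
    expansion = norm₃-1+ (T ⊛₃ split h)
      ⟨≈⟩ ⊕-congˡ (const (+ 1) ⊕ const (+ 3) ⊛ trace h) (norm₃-⊛₃ T (split h) ⟨≈⟩ ⊛-congʳ (norm₃ (split h)) norm₃[ρ^e])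

  step : (∀ t h → ∃ λ Y → const (+ 3) ⊛ trace h ≈ ρ ^ₚ suc e ⊛ Y [mod Φ3 (suc (suc t)) ]) →
         ∀ t h {m} → NormEq (suc (suc (suc t))) (1+ρ^ e h) m →
         ∃ λ h′ → NormEq (suc (suc t)) (1+ρ^ e h′) m × ((+ 3 ∣ at1 h′) ⇔ (+ 3 ∣ at1 h))
  step 3⊛trace t h {m} normEq = h′ , ≈mod⇒NormEq {suc (suc t)} {1+ρ^ e h′} lowered , residue
    where
    open Congruence (modulo (Φ3 (suc (suc t))))
    N = norm₃ (split h)
    Y = proj₁ (3⊛trace t h)
    h′ = N ⊕ ρ ⊛ Y
    congruence : 1+ρ^ e h′ ∼ const (+ 1) ⊕ const (+ 3) ⊛ trace h ⊕ ρ ^ₚ e ⊛ N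
    congruence = ∼-trans
      (≈⇒∼ (solve 4 (λ r P N Y → con (+ 1) :+ P :* (N :+ r :* Y) := con (+ 1) :+ (r :* P) :* Y :+ P :* N)
        ≈-refl ρ (ρ ^ₚ e) N Y))
      (+-cong (+-congˡ (const (+ 1)) (∼-sym (proj₂ (3⊛trace t h)))) ∼-refl)
    lowered : normPoly (suc (suc t)) (1+ρ^ e h′) ≈ const m [mod Φ3 (suc (suc t)) ]
    lowered = ∼-trans (normPoly-resp-mod (suc t) congruence)
      (NormEq⇒≈mod {suc (suc t)} {const (+ 1) ⊕ const (+ 3) ⊛ trace h ⊕ ρ ^ₚ e ⊛ N} (relativeNorm-1+ρ^ (suc t) h normEq))
    residue : (+ 3 ∣ at1 h′) ⇔ (+ 3 ∣ at1 h)
    residue = ⇔-trans (≡⇒⇔∣ (+ 3) at1-h′) (⇔-trans (3∣at1-norm₃⇔3∣at1 (split h)) (≡⇒⇔∣ (+ 3) (at1-cong (⟦split⟧ h))))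
      where
      at1-h′ : at1 h′ ≡ at1 N
      at1-h′ = trans (at1-⊕ N (ρ ⊛ Y)) (trans (cong (λ x → at1 N + x) (at1-⊛ ρ Y)) (ℤₚ.+-identityʳ (at1 N)))

-- Since (X − 1)³ ≡ X³ − 1 (mod 3), the components of (X − 1)⁵ are all ≡ X − 1 and those
-- of (X − 1)⁷ are ≡ −(X − 1)², (X − 1)², 0 modulo 3.
𝟙₃ t₅ u₇ v₇ : Split
𝟙₃ = const (+ 1) , const (+ 1) , const (+ 1)
t₅ = + 0 ∷ + 3 ∷ [] , + 2 ∷ - + 2 ∷ [] , const (- + 3)
u₇ = const (- + 1) , const (+ 1) , []
v₇ = + 0 ∷ + 11 ∷ - + 2 ∷ [] , + 2 ∷ - + 11 ∷ [] , - + 7 ∷ + 7 ∷ []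

split-ρ⁵ : split (ρ ^ₚ 5) ≈₃ ρ ·₃ 𝟙₃ ⊕₃ const (+ 3) ·₃ t₅
split-ρ⁵ = from-yes (split (ρ ^ₚ 5) ≈₃? ρ ·₃ 𝟙₃ ⊕₃ const (+ 3) ·₃ t₅)

split-ρ⁷ : split (ρ ^ₚ 7) ≈₃ ρ ^ₚ 2 ·₃ u₇ ⊕₃ const (+ 3) ·₃ v₇
split-ρ⁷ = from-yes (split (ρ ^ₚ 7) ≈₃? ρ ^ₚ 2 ·₃ u₇ ⊕₃ const (+ 3) ·₃ v₇)

-- The norm of X − 1 down to ℤ[X³] is X³ − 1.
module Lowering₅ = Lowering 5 (from-yes (norm₃ (split (ρ ^ₚ 5)) ≈? ρ ^ₚ 5))
module Lowering₇ = Lowering 7 (from-yes (norm₃ (split (ρ ^ₚ 7)) ≈? ρ ^ₚ 7))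

3⊛-ρ⁶-multiple : ∀ t p → ∃ λ Y → const (+ 3) ⊛ p ≈ ρ ^ₚ 6 ⊛ Y [mod Φ3 (suc (suc t)) ]
3⊛-ρ⁶-multiple t p = let (V , 3≈ρ⁶V′) = 3≈ρ⁶V t in
  V ⊛ p , ∼-trans (*-cong 3≈ρ⁶V′ (∼-refl {p})) (≈⇒∼ (⊛-assoc (ρ ^ₚ 6) V p))
  where open Congruence (modulo (Φ3 (suc (suc t))))

3⊛trace₅-multiple : ∀ t h → ∃ λ Y → const (+ 3) ⊛ Lowering₅.trace h ≈ ρ ^ₚ 6 ⊛ Y [mod Φ3 (suc (suc t)) ]
3⊛trace₅-multiple t h = 3⊛-ρ⁶-multiple t (Lowering₅.trace h)

3⊛∈-ρ⁸-multiple : ∀ t {p} → p ∈⟨3, ρ ^ₚ 2 ⟩ → ∃ λ Y → const (+ 3) ⊛ p ≈ ρ ^ₚ 8 ⊛ Y [mod Φ3 (suc (suc t)) ]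
3⊛∈-ρ⁸-multiple t (combination u v p≈) = let (V , 3≈ρ⁶V′) = 3≈ρ⁶V t in
  ρ ^ₚ 4 ⊛ V ⊛ V ⊛ u ⊕ V ⊛ v ,
  ∼-trans (*-congˡ (const (+ 3)) (≈⇒∼ p≈))
  (∼-trans (*-cong 3≈ρ⁶V′ (+-cong (*-cong 3≈ρ⁶V′ (∼-refl {u})) (∼-refl {ρ ^ₚ 2 ⊛ v})))
           (≈⇒∼ (solve 4 (λ r V u v → (r :^ 6 :* V) :* ((r :^ 6 :* V) :* u :+ r :^ 2 :* v)
                                    := r :^ 8 :* (r :^ 4 :* V :* V :* u :+ V :* v)) ≈-refl ρ V u v)))
  where open Congruence (modulo (Φ3 (suc (suc t))))

3⊛trace₇-multiple : ∀ t h → ∃ λ Y → const (+ 3) ⊛ Lowering₇.trace h ≈ ρ ^ₚ 8 ⊛ Y [mod Φ3 (suc (suc t)) ]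
3⊛trace₇-multiple t h = 3⊛∈-ρ⁸-multiple t (traceTerm-⊛₃-∈ (ρ ^ₚ 2) u₇ v₇ (split (ρ ^ₚ 7)) split-ρ⁷ (split h))

-- Level 1

module ℤ[ω] = Congruence (modulo (Φ3 1))

N₁[1-X]≈3 : normPoly 1 (const (+ 1) ⊟ X) ≈ const (+ 3) [mod Φ3 1 ]
N₁[1-X]≈3 = congruent (- + 2 ∷ + 1 ∷ []) (from-yes (normPoly 1 (const (+ 1) ⊟ X) ≈? const (+ 3) ⊕ Φ3 1 ⊛ (- + 2 ∷ + 1 ∷ [])))

-- ρ² ≡ −3X and X³ ≡ 1 modulo Φ3 1.
ρ⁶≈-27 : ρ ^ₚ 6 ≈ const (- + 27) [mod Φ3 1 ]
ρ⁶≈-27 = congruent K (from-yes (ρ ^ₚ 6 ≈? const (- + 27) ⊕ Φ3 1 ⊛ K))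
  where K = + 28 ∷ - + 34 ∷ + 21 ∷ - + 7 ∷ + 1 ∷ []

3ρ-reduce : ∀ {a} b c → a ≈ ρ ⊛ b ⊕ const (+ 3) ⊛ c → const (+ 3) ⊛ ρ ⊛ a ≈ const (+ 9) ⊛ (ρ ⊛ c ⊟ X ⊛ b) [mod Φ3 1 ]
3ρ-reduce b c a≈ = congruent (const (+ 3) ⊛ b) (⊛-congˡ (const (+ 3) ⊛ ρ) a≈ ⟨≈⟩
  solve 3 (λ x b c → con (+ 3) :* (x :- con (+ 1)) :* ((x :- con (+ 1)) :* b :+ con (+ 3) :* c)
                   := con (+ 9) :* ((x :- con (+ 1)) :* c :- x :* b) :+ (con (+ 1) :+ x :^ 1 :+ x :^ 2) :* (con (+ 3) :* b))
    ≈-refl X b c)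

const-difference : ∀ a b → const (a - b) ≈ const a ⊟ const b
const-difference a b = ∷-cong (cong (λ z → a + z) (sym (ℤₚ.-1*i≡-i b))) ≈-refl

ℤ[ω]-coordinates : ∀ p → ∃₂ λ α β → p ≈ const α ⊕ β · X [mod Φ3 1 ]
ℤ[ω]-coordinates []      = + 0 , + 0 , ≈⇒≈mod (from-yes ([] ≈? const (+ 0) ⊕ (+ 0) · X))
ℤ[ω]-coordinates (c ∷ p) = c - β , α - β , congruent (const β ⊕ X ⊛ Q) reduced
  where
  α = proj₁ (ℤ[ω]-coordinates p)
  β = proj₁ (proj₂ (ℤ[ω]-coordinates p))
  p≈ = proj₂ (proj₂ (ℤ[ω]-coordinates p))
  Q = cofactor p≈
  -- X² ≡ −1 − X modulo Φ3 1
  reduced : c ∷ p ≈ const (c - β) ⊕ (α - β) · X ⊕ Φ3 1 ⊛ (const β ⊕ X ⊛ Q)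
  reduced =
    ∷≈const⊕X⊛ c p
    ⟨≈⟩ ⊕-congˡ (const c) (⊛-congˡ X (difference p≈ ⟨≈⟩ ⊕-congʳ (Φ3 1 ⊛ Q) (⊕-congˡ (const α) (·≈const⊛ β X))))
    ⟨≈⟩ solve 5 (λ x C A B Q → C :+ x :* ((A :+ B :* x) :+ (con (+ 1) :+ x :^ 1 :+ x :^ 2) :* Q)
                             := (C :- B) :+ (A :- B) :* x :+ (con (+ 1) :+ x :^ 1 :+ x :^ 2) :* (B :+ x :* Q))
        ≈-refl X (const c) (const α) (const β) Q
    ⟨≈⟩ ≈-sym (⊕-congʳ (Φ3 1 ⊛ (const β ⊕ X ⊛ Q))
          (⊕-cong (const-difference c β) (·≈const⊛ (α - β) X ⟨≈⟩ ⊛-congʳ X (const-difference α β))))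

at1-mod : ∀ {p q M} (p≈q : p ≈ q [mod M ]) → at1 p ≡ at1 q + at1 M * at1 (cofactor p≈q)
at1-mod {q = q} {M} (congruent Q e) = trans (at1-cong e) (trans (at1-⊕ q (M ⊛ Q)) (cong (λ z → at1 q + z) (at1-⊛ M Q)))

at1-α+βX : ∀ α β → at1 (const α ⊕ β · X) ≡ α + β
at1-α+βX α β = trans (at1-⊕ (const α) (β · X)) (cong₂ _+_ (ℤₚ.+-identityʳ α) (trans (at1-· β X) (ℤₚ.*-identityʳ β)))

module AtLevel2 (h : Poly) where

  H = split h
  a = Lowering₅.T ⊛₃ H
  b = 𝟙₃ ⊛₃ H
  c = t₅ ⊛₃ H
  a₀ = proj₁ a
  a₁ = proj₁ (proj₂ a)
  a₂ = proj₂ (proj₂ a)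
  b₀ = proj₁ b
  b₁ = proj₁ (proj₂ b)
  c₀ = proj₁ c
  c₁ = proj₁ (proj₂ c)
  a≈ρb+3c : a ≈₃ ρ ·₃ b ⊕₃ const (+ 3) ·₃ c
  a≈ρb+3c = ⊛₃-mod3 ρ 𝟙₃ t₅ Lowering₅.T H split-ρ⁵

  N = norm₃ H
  R = const (+ 1) ⊕ const (+ 3) ⊛ Lowering₅.trace h ⊕ ρ ^ₚ 5 ⊛ N
  ℓ₀ = ρ ⊛ c₀ ⊟ X ⊛ b₀
  ℓ₁ = ρ ⊛ c₁ ⊟ X ⊛ b₁
  E₉ = const (+ 3) ⊛ N ⊟ (ℓ₀ ⊕ ℓ₀ ⊛ a₀ ⊟ X ⊛ ℓ₁ ⊛ a₂)

  -- Writing aᵢ = ρ bᵢ + 3 cᵢ, each 3ρ aᵢ is 9(ρ cᵢ − X bᵢ) since ρ² ≡ −3X.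
  [1-X]R≈1-X+9E₉ : (const (+ 1) ⊟ X) ⊛ R ≈ (const (+ 1) ⊟ X) ⊕ const (+ 9) ⊛ E₉ [mod Φ3 1 ]
  [1-X]R≈1-X+9E₉ = ℤ[ω].∼-trans
    (ℤ[ω].≈⇒∼ (solve 5 (λ x a₀ a₁ a₂ N →
      let r = x :- con (+ 1) in
      (con (+ 1) :- x) :* (con (+ 1) :+ con (+ 3) :* (a₀ :+ a₀ :* a₀ :- x :* a₁ :* a₂) :+ r :^ 5 :* N)
      := F (con (+ 3) :* r :* a₀) (con (+ 3) :* r :* a₁) (r :^ 6) x a₀ a₂ N) ≈-refl X a₀ a₁ a₂ N))
    (∼-trans (F-cong (3ρ-reduce b₀ c₀ (proj₁ a≈ρb+3c)) (3ρ-reduce b₁ c₁ (proj₁ (proj₂ a≈ρb+3c))) ρ⁶≈-27)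
    (≈⇒∼ (solve 6 (λ x ℓ₀ ℓ₁ a₀ a₂ N →
      F (con (+ 9) :* ℓ₀) (con (+ 9) :* ℓ₁) (con (- + 27)) x a₀ a₂ N
      := (con (+ 1) :- x) :+ con (+ 9) :* (con (+ 3) :* N :- (ℓ₀ :+ ℓ₀ :* a₀ :- x :* ℓ₁ :* a₂))) ≈-refl X ℓ₀ ℓ₁ a₀ a₂ N)))
    where
    open ℤ[ω]
    F : ∀ {n} → (P₀ P₁ S x a₀ a₂ N : ℤ[X]-Solver.Polynomial n) → ℤ[X]-Solver.Polynomial n
    F P₀ P₁ S x a₀ a₂ N = (con (+ 1) :- x) :- (P₀ :+ P₀ :* a₀ :- x :* P₁ :* a₂) :- S :* N
    F-cong : ∀ {P₀ P₀′ P₁ P₁′ S S′} → P₀ ∼ P₀′ → P₁ ∼ P₁′ → S ∼ S′ →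
      (const (+ 1) ⊟ X) ⊟ (P₀ ⊕ P₀ ⊛ a₀ ⊟ X ⊛ P₁ ⊛ a₂) ⊟ S ⊛ N
      ∼ (const (+ 1) ⊟ X) ⊟ (P₀′ ⊕ P₀′ ⊛ a₀ ⊟ X ⊛ P₁′ ⊛ a₂) ⊟ S′ ⊛ N
    F-cong P₀∼ P₁∼ S∼ = +-cong (+-congˡ (const (+ 1) ⊟ X)
      (neg-cong (+-cong (+-cong P₀∼ (*-cong P₀∼ ∼-refl)) (neg-cong (*-cong (*-congˡ X P₁∼) ∼-refl)))))
      (neg-cong (*-cong S∼ ∼-refl))

  b₂ = proj₂ (proj₂ b)
  c₂ = proj₂ (proj₂ c)

  D = const (+ 3) ⊛ N ⊟ ρ ⊛ c₀ ⊟ ℓ₀ ⊛ a₀ ⊕ X ⊛ ℓ₁ ⊛ a₂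

  D∈⟨3,ρ⟩ : D ∈⟨3, ρ ⟩
  D∈⟨3,ρ⟩ = ∈-⊕ (∈-⊕ (∈-⊕ (3⊛∈ N) (∈-neg (g⊛∈ c₀))) (∈-neg (∈-⊛ˡ ℓ₀ a₀∈))) (∈-⊛ˡ (X ⊛ ℓ₁) a₂∈)
    where
    a₀∈ = mod3⇒∈ b₀ c₀ (proj₁ a≈ρb+3c)
    a₂∈ = mod3⇒∈ b₂ c₂ (proj₂ (proj₂ a≈ρb+3c))

  E₉≈Xb₀+D : E₉ ≈ X ⊛ b₀ ⊕ D
  E₉≈Xb₀+D = solve 7 (λ x b₀ c₀ a₀ ℓ₁ a₂ N →
    let r = x :- con (+ 1) ; ℓ₀ = r :* c₀ :- x :* b₀ in
    con (+ 3) :* N :- (ℓ₀ :+ ℓ₀ :* a₀ :- x :* ℓ₁ :* a₂)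
    := x :* b₀ :+ (con (+ 3) :* N :- r :* c₀ :- ℓ₀ :* a₀ :+ x :* ℓ₁ :* a₂)) ≈-refl X b₀ c₀ a₀ ℓ₁ a₂ N

  at1-b₀ : at1 b₀ ≡ at1 h
  at1-b₀ = begin
    at1 (const (+ 1) ⊛ H₀ ⊕ X ⊛ (const (+ 1) ⊛ H₂ ⊕ const (+ 1) ⊛ H₁))
      ≡⟨ at1-⊕ (const (+ 1) ⊛ H₀) (X ⊛ (const (+ 1) ⊛ H₂ ⊕ const (+ 1) ⊛ H₁)) ⟩
    at1 (const (+ 1) ⊛ H₀) + at1 (X ⊛ (const (+ 1) ⊛ H₂ ⊕ const (+ 1) ⊛ H₁))
      ≡⟨ cong₂ _+_ (at1-⊛ (const (+ 1)) H₀) (trans (at1-⊛ X (const (+ 1) ⊛ H₂ ⊕ const (+ 1) ⊛ H₁))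
           (cong (+ 1 *_) (trans (at1-⊕ (const (+ 1) ⊛ H₂) (const (+ 1) ⊛ H₁))
             (cong₂ _+_ (at1-⊛ (const (+ 1)) H₂) (at1-⊛ (const (+ 1)) H₁))))) ⟩
    + 1 * at1 H₀ + + 1 * (+ 1 * at1 H₂ + + 1 * at1 H₁)
      ≡⟨ reorder (at1 H₀) (at1 H₁) (at1 H₂) ⟩
    at1 H₀ + at1 H₁ + at1 H₂
      ≡⟨ at1-⟦⟧ H₀ H₁ H₂ ⟨
    at1 ⟦ H ⟧
      ≡⟨ at1-cong (⟦split⟧ h) ⟩
    at1 h ∎
    where
    open ≡-Reasoning
    H₀ = proj₁ H
    H₁ = proj₁ (proj₂ H)
    H₂ = proj₂ (proj₂ H)
    reorder : ∀ x y z → + 1 * x + + 1 * (+ 1 * z + + 1 * y) ≡ x + y + z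
    reorder = solve-∀

  at1-E₉ : at1 E₉ ≡ at1 h + + 3 * at1 (u D∈⟨3,ρ⟩)
  at1-E₉ = begin
    at1 E₉                         ≡⟨ at1-cong E₉≈Xb₀+D ⟩
    at1 (X ⊛ b₀ ⊕ D)               ≡⟨ at1-⊕ (X ⊛ b₀) D ⟩
    at1 (X ⊛ b₀) + at1 D           ≡⟨ cong₂ _+_ (trans (at1-⊛ X b₀) (trans (ℤₚ.*-identityˡ (at1 b₀)) at1-b₀))
                                                 (at1-∈ D∈⟨3,ρ⟩ refl) ⟩
    at1 h + + 3 * at1 (u D∈⟨3,ρ⟩)  ∎
    where open ≡-Reasoning

const-* : ∀ a b → const (a * b) ≈ const a ⊛ const b
const-* a b = ∷-cong (sym (ℤₚ.+-identityʳ (a * b))) ≈-refl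

target : ℤ → ℤ → Poly
target A B = (const (+ 1) ⊟ X) ⊕ (+ 9) · (const A ⊕ B · (const (+ 1) ⊟ X))

target-coordinates : ∀ α β → target (α + β) (- β) ≈ (const (+ 1) ⊟ X) ⊕ const (+ 9) ⊛ (const α ⊕ β · X)
target-coordinates α β =
  ⊕-congˡ (const (+ 1) ⊟ X) (·≈const⊛ (+ 9) (const (α + β) ⊕ (- β) · (const (+ 1) ⊟ X)) ⟨≈⟩ ⊛-congˡ (const (+ 9))
    (⊕-congˡ (const (α + β)) (·≈const⊛ (- β) (const (+ 1) ⊟ X) ⟨≈⟩ ⊛-congʳ (const (+ 1) ⊟ X) const[-β]≈neg)))
  ⟨≈⟩ solve 3 (λ x A B → (con (+ 1) :- x) :+ con (+ 9) :* (A :+ B :+ (:- B) :* (con (+ 1) :- x))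
                       := (con (+ 1) :- x) :+ con (+ 9) :* (A :+ B :* x)) ≈-refl X (const α) (const β)
  ⟨≈⟩ ⊕-congˡ (const (+ 1) ⊟ X) (⊛-congˡ (const (+ 9)) (⊕-congˡ (const α) (≈-sym (·≈const⊛ β X))))
  where
  const[-β]≈neg : const (- β) ≈ neg (const β)
  const[-β]≈neg = ∷-cong (sym (ℤₚ.-1*i≡-i β)) (≈-refl {[]})

level2→1 : ∀ h {m} → NormEq 2 (1+ρ^ 5 h) m →
           ∃₂ λ A B → NormEq 1 (target A B) (+ 3 * m) × ((+ 3 ∣ A) ⇔ (+ 3 ∣ at1 h))
level2→1 h {m} normEq =
  α + β , - β , ≈mod⇒NormEq {1} {target (α + β) (- β)} normEq₁ , ⇔-trans (≡⇒⇔∣ (+ 3) α+β≡) (∣m+d*k⇔∣m (+ 3) (at1 h) _)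
  where
  open AtLevel2 h
  open ℤ[ω] using (∼-trans; ∼-sym; ≈⇒∼; +-congˡ; *-congˡ; *-cong)
  α = proj₁ (ℤ[ω]-coordinates E₉)
  β = proj₁ (proj₂ (ℤ[ω]-coordinates E₉))
  E₉≈α+βX = proj₂ (proj₂ (ℤ[ω]-coordinates E₉))

  normEq₁ : normPoly 1 (target (α + β) (- β)) ≈ const (+ 3 * m) [mod Φ3 1 ]
  normEq₁ = ∼-trans (normPoly-resp-mod 0 target≈[1-X]R)
    (∼-trans (≈⇒∼ (normPoly-⊛ 1 (const (+ 1) ⊟ X) R))
    (∼-trans (*-cong N₁[1-X]≈3 (NormEq⇒≈mod {1} {R} (Lowering₅.relativeNorm-1+ρ^ 0 h normEq)))
             (≈⇒∼ (≈-sym (const-* (+ 3) m)))))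
    where
    target≈[1-X]R : target (α + β) (- β) ≈ (const (+ 1) ⊟ X) ⊛ R [mod Φ3 1 ]
    target≈[1-X]R = ∼-trans (≈⇒∼ (target-coordinates α β))
      (∼-trans (+-congˡ (const (+ 1) ⊟ X) (*-congˡ (const (+ 9)) (∼-sym E₉≈α+βX))) (∼-sym [1-X]R≈1-X+9E₉))

  α+β≡ : α + β ≡ at1 h + + 3 * (at1 (u D∈⟨3,ρ⟩) - at1 (cofactor E₉≈α+βX))
  α+β≡ = rearrange (α + β) (at1 h) (at1 (u D∈⟨3,ρ⟩)) (at1 (cofactor E₉≈α+βX))
    (trans (sym (trans (at1-mod E₉≈α+βX) (cong (_+ + 3 * at1 (cofactor E₉≈α+βX)) (at1-α+βX α β)))) at1-E₉)
    where
    rearrange : ∀ A s k q → A + + 3 * q ≡ s + + 3 * k → A ≡ s + + 3 * (k - q)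
    rearrange A s k q e = trans (cancel A q) (trans (cong (_- + 3 * q) e) (regroup s k q))
      where
      cancel : ∀ A q → A ≡ A + + 3 * q - + 3 * q
      cancel = solve-∀
      regroup : ∀ s k q → s + + 3 * k - + 3 * q ≡ s + + 3 * (k - q)
      regroup = solve-∀

descend : ∀ {P : ℕ → Poly → Set} →
  (∀ t h → P (suc (suc (suc t))) h → ∃ λ h′ → P (suc (suc t)) h′ × ((+ 3 ∣ at1 h′) ⇔ (+ 3 ∣ at1 h))) →
  ∀ {i j} → 2 ≤ j → j ≤ i → ∀ h → P i h → ∃ λ h′ → P j h′ × ((+ 3 ∣ at1 h′) ⇔ (+ 3 ∣ at1 h))
descend {P} step {i} {suc (suc t)} (s≤s (s≤s z≤n)) j≤i h Pih =
  go d h (subst (λ n → P n h) i≡ Pih)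
  where
  go : ∀ d h → P (suc (suc (d ℕ.+ t))) h → ∃ λ h′ → P (suc (suc t)) h′ × ((+ 3 ∣ at1 h′) ⇔ (+ 3 ∣ at1 h))
  go zero    h Ph = h , Ph , ⇔-refl
  go (suc d) h Ph =
    let (h₁ , Ph₁ , h₁~h) = step (d ℕ.+ t) h Ph
        (h₂ , Ph₂ , h₂~h₁) = go d h₁ Ph₁
    in h₂ , Ph₂ , ⇔-trans h₂~h₁ h₁~h
  d = proj₁ (ℕₚ.m≤n⇒∃[o]m+o≡n j≤i)
  i≡ : i ≡ suc (suc (d ℕ.+ t))
  i≡ = trans (sym (proj₂ (ℕₚ.m≤n⇒∃[o]m+o≡n j≤i))) (cong (λ n → suc (suc n)) (ℕₚ.+-comm t d))

lemma4p4 : (m : ℤ) (i : ℕ) → 2 ≤ i →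
    ((h : Poly) → NormEq i (const (+ 1) ⊕ (((X ⊟ const (+ 1)) ^ₚ 5) ⊛ h)) m →
      ((j : ℕ) → 2 ≤ j → j ≤ i →
        ∃ λ (hj : Poly) → NormEq j (const (+ 1) ⊕ (((X ⊟ const (+ 1)) ^ₚ 5) ⊛ hj)) m
          × ((+ 3 ∣ at1 hj) ⇔ (+ 3 ∣ at1 h)))
      × ∃₂ λ (A B : ℤ) →
          NormEq 1 ((const (+ 1) ⊟ X) ⊕ ((+ 9) · (const A ⊕ (B · (const (+ 1) ⊟ X))))) (+ 3 * m)
          × (¬ (+ 3 ∣ at1 h) → ¬ (+ 3 ∣ A))
          × ((+ 3 ∣ at1 h) → + 3 ∣ A))
    ×
    ((t : Poly) → NormEq i (const (+ 1) ⊕ (((X ⊟ const (+ 1)) ^ₚ 7) ⊛ t)) m →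
      (j : ℕ) → 2 ≤ j → j ≤ i →
        ∃ λ (tj : Poly) → NormEq j (const (+ 1) ⊕ (((X ⊟ const (+ 1)) ^ₚ 7) ⊛ tj)) m
          × ((+ 3 ∣ at1 tj) ⇔ (+ 3 ∣ at1 t)))
lemma4p4 m i 2≤i = part-i , part-ii
  where
  descend₅ = descend (λ t h → Lowering₅.step 3⊛trace₅-multiple t h {m})
  descend₇ = descend (λ t h → Lowering₇.step 3⊛trace₇-multiple t h {m})
  part-i = λ h normEq →
    let (h₂ , normEq₂ , h₂~h) = descend₅ (s≤s (s≤s z≤n)) 2≤i h normEq
        (A , B , normEq₁ , A~h₂) = level2→1 h₂ normEq₂
    in (λ j 2≤j j≤i → descend₅ 2≤j j≤i h normEq)
       , A , B , normEq₁
       , (λ 3∤h 3∣A → 3∤h (Equivalence.to h₂~h (Equivalence.to A~h₂ 3∣A)))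
       , (λ 3∣h → Equivalence.from A~h₂ (Equivalence.from h₂~h 3∣h))
  part-ii = λ t normEq j 2≤j j≤i → descend₇ 2≤j j≤i t normEq
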